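{- Let $\lambda\supseteq\mu$ be strict partitions and $n$ a positive integer such that $\mathrm{SSVT}_P(\lambda/\mu,n)\neq\emptyset$ and $\mathrm{SSVT}_Q(\lambda/\mu,n)\neq\emptyset$. Then, as Laurent polynomials in $\beta$, $$GP_{\lambda/\mu}(\beta,\dots,\beta \mid -\beta^{ -1})=\beta^{|\lambda/\mu|},\qquad GQ_{\lambda/\mu}(\beta,\dots,\beta \mid -\beta^{ -1})=\beta^{|\lambda/\mu|},$$ where all $n$ variables are specialized to $\beta$ and the parameter to $-\beta^{ -1}$.
   Context: Strict partitions $\lambda=(\lambda_1>\dots>\lambda_r>0)$, $\ell(\lambda)=r$, $|\lambda|=\sum\lambda_i$. For strict partitions with $\lambda_i\ge\mu_i$ for all $i$ (pad $\mu$ with zeros) write $\lambda\supseteq\mu$. The shifted skew diagram is $\lambda/\mu=\{(i,j): 1\le i\le\ell(\lambda),\ \mu_i+i\le j\le\lambda_i+i-1\}$, $|\lambda/\mu|=|\lambda|-|\mu|$ is its number of boxes, and boxes of the form $(i,i)$ are called diagonal. For $k\in[n]$ put $k'=k-\tfrac12$ and $[n',n]=\{1'<1<2'<2<\dots<n'<n\}$. A shifted skew set-valued tableau of shape $\lambda/\mu$ with $n$ variables assigns to each box $(i,j)\in\lambda/\mu$ a nonempty subset $T_{i,j}\subseteq[n',n]$ such that: (1) $\max T_{i,j}\le\min T_{i,j+1}$ and $\max T_{i,j}\le\min T_{i+1,j}$ whenever both boxes are in $\lambda/\mu$; (2) each unprimed $k$ appears at most once in each column; (3) each primed $k'$ appears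 at most once in each row; (4) diagonal boxes contain only unprimed entries. $\mathrm{SSVT}_P(\lambda/\mu,n)$ is the set of these; $\mathrm{SSVT}_Q(\lambda/\mu,n)$ is the set satisfying (1)–(3) only. $|T|$ is the total number of entries, $\omega_k(T)$ the number of occurrences of $k$ or $k'$, $x^{\omega(T)}=\prod_k x_k^{\omega_k(T)}$. Define $GP_{\lambda/\mu}(x\mid\beta)=\sum_{T\in\mathrm{SSVT}_P(\lambda/\mu,n)}\beta^{|T|-|\lambda/\mu|}x^{\omega(T)}$ and $GQ_{\lambda/\mu}(x\mid\beta)=\sum_{T\in\mathrm{SSVT}_Q(\lambda/\mu,n)}\beta^{|T|-|\lambda/\mu|}x^{\omega(T)}$. -}

module Defs where

open import Data.Nat as ℕ using (ℕ; zero; suc; _+_; _∸_; _<_; _≤_; _≡ᵇ_; _≤ᵇ_; _%_; _/_)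
open import Data.Bool using (Bool; true; false; _∧_; _∨_; not; if_then_else_)
open import Data.List as L using (List; []; _∷_; length; map; concatMap; upTo; allFin; filter)
open import Data.Bool.ListAction using (all; any)
open import Data.Nat.ListAction using (sum)
open import Relation.Nullary.Decidable using (T?)
open import Data.List.Relation.Unary.All using (All)
open import Data.List.Relation.Unary.Linked using (Linked)
open import Data.Vec as V using (Vec; []; _∷_)
open import Data.Fin using (Fin; toℕ)
open import Data.Fin.Subset using (Subset)
open import Data.Integer as ℤ using (ℤ; +_; -_)
open import Data.Product using (_×_; _,_; proj₁; proj₂; ∃)
open import Relation.Nullary using (does)
open import Relation.Binary.PropositionalEquality using (_≡_)

IsStrictPartition : List ℕ → Set
IsStrictPartition p = All (0 <_) p × Linked (λ a b → b < a) p

-- i-th part (1-indexed), padded with zeros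
part : List ℕ → ℕ → ℕ
part []       _             = 0
part (x ∷ xs) zero          = 0
part (x ∷ xs) (suc zero)    = x
part (x ∷ xs) (suc (suc i)) = part xs (suc i)

_⊇_ : List ℕ → List ℕ → Set
la ⊇ mu = ∀ (i : ℕ) → part mu i ≤ part la i

size : List ℕ → ℕ
size = sum

skewSize : List ℕ → List ℕ → ℕ
skewSize la mu = size la ∸ size mu

-- the boxes (i,j) of the shifted skew diagram λ/μ:
-- 1 ≤ i ≤ ℓ(λ), μᵢ + i ≤ j ≤ λᵢ + i - 1
boxes : List ℕ → List ℕ → List (ℕ × ℕ)
boxes la mu =
  concatMap (λ i → map (λ k → (i , part mu i + i + k)) (upTo (part la i ∸ part mu i)))
            (map suc (upTo (length la)))

-- Alphabet [n',n] = {1' < 1 < 2' < 2 < … < n' < n} encoded as Fin (2n):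
-- the letter with code c ∈ {0,…,2n-1} is  k' (k = c/2 + 1) if c is even,
-- and k (k = c/2 + 1) if c is odd.  The order on codes is the order of letters.

Letter : ℕ → Set
Letter n = Fin (2 ℕ.* n)

isPrimed : ∀ n → Letter n → Bool
isPrimed n a = toℕ a % 2 ≡ᵇ 0

letterIndex : ∀ n → Letter n → ℕ
letterIndex n a = suc (toℕ a / 2)

-- Laurent polynomials in β with integer coefficients, as finite lists of
-- monomials (coefficient , exponent); equality = equality of all coefficients.

LPoly : Set
LPoly = List (ℤ × ℤ)

coeff : LPoly → ℤ → ℤ
coeff []             e = + 0
coeff ((c , d) ∷ ps) e = (if does (d ℤ.≟ e) then c else + 0) ℤ.+ coeff ps e

_≈L_ : LPoly → LPoly → Set
p ≈L q = ∀ e → coeff p e ≡ coeff q e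

-- a filling assigns to the m-th box of  boxes λ μ  a subset of [n',n]
Filling : ℕ → List ℕ → List ℕ → Set
Filling n la mu = Vec (Subset (2 ℕ.* n)) (length (boxes la mu))

_==_ : ℕ → ℕ → Bool
_==_ = _≡ᵇ_

allVecs : ∀ {A : Set} → List A → (m : ℕ) → List (Vec A m)
allVecs xs zero    = [] ∷ []
allVecs xs (suc m) = concatMap (λ x → map (x ∷_) (allVecs xs m)) xs

signPow : ℕ → ℤ
signPow zero    = + 1
signPow (suc m) = - signPow m

module Tab (n : ℕ) (la mu : List ℕ) where

  N : ℕ
  N = length (boxes la mu)

  Pos : Set
  Pos = Fin N

  box : Pos → ℕ × ℕ
  box p = L.lookup (boxes la mu) p

  entry : Filling n la mu → Pos → Letter n → Bool
  entry T p a = V.lookup (V.lookup T p) a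

  allL : (Letter n → Bool) → Bool
  allL f = all f (allFin (2 ℕ.* n))

  anyL : (Letter n → Bool) → Bool
  anyL f = any f (allFin (2 ℕ.* n))

  allP : (Pos → Bool) → Bool
  allP f = all f (allFin N)

  nonemptyBoxes : Filling n la mu → Bool
  nonemptyBoxes T = allP (λ p → anyL (entry T p))

  maxLeMin : (Letter n → Bool) → (Letter n → Bool) → Bool
  maxLeMin S S' = allL (λ a → allL (λ b → not (S a ∧ S' b) ∨ (toℕ a ≤ᵇ toℕ b)))

  -- (1) max T_{i,j} ≤ min T_{i,j+1} and max T_{i,j} ≤ min T_{i+1,j}
  cond1 : Filling n la mu → Bool
  cond1 T = allP (λ p → allP (λ q →
    not (((proj₁ (box p) == proj₁ (box q)) ∧ (proj₂ (box q) == suc (proj₂ (box p))))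
         ∨ ((proj₂ (box p) == proj₂ (box q)) ∧ (proj₁ (box q) == suc (proj₁ (box p)))))
    ∨ maxLeMin (entry T p) (entry T q)))

  -- (2) each unprimed k at most once per column
  -- (within a single box it appears at most once since entries are sets)
  cond2 : Filling n la mu → Bool
  cond2 T = allP (λ p → allP (λ q →
    not ((proj₂ (box p) == proj₂ (box q)) ∧ not (proj₁ (box p) == proj₁ (box q)))
    ∨ allL (λ a → isPrimed n a ∨ not (entry T p a ∧ entry T q a))))

  -- (3) each primed k' at most once per row
  cond3 : Filling n la mu → Bool
  cond3 T = allP (λ p → allP (λ q →
    not ((proj₁ (box p) == proj₁ (box q)) ∧ not (proj₂ (box p) == proj₂ (box q)))
    ∨ allL (λ a → not (isPrimed n a) ∨ not (entry T p a ∧ entry T q a))))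

  -- (4) diagonal boxes contain only unprimed entries
  cond4 : Filling n la mu → Bool
  cond4 T = allP (λ p →
    not (proj₁ (box p) == proj₂ (box p)) ∨ allL (λ a → not (isPrimed n a ∧ entry T p a)))

  isSSVT-P : Filling n la mu → Bool
  isSSVT-P T = nonemptyBoxes T ∧ cond1 T ∧ cond2 T ∧ cond3 T ∧ cond4 T

  isSSVT-Q : Filling n la mu → Bool
  isSSVT-Q T = nonemptyBoxes T ∧ cond1 T ∧ cond2 T ∧ cond3 T

  allFillings : List (Filling n la mu)
  allFillings = allVecs (allVecs (true ∷ false ∷ []) (2 ℕ.* n)) N

  count : (Letter n → Bool) → ℕ
  count f = length (filter (λ a → T? (f a)) (allFin (2 ℕ.* n)))

  totalSize : Filling n la mu → ℕ
  totalSize T = sum (map (λ p → count (entry T p)) (allFin N))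

  omega : Filling n la mu → ℕ → ℕ
  omega T k = sum (map (λ p → count (λ a → entry T p a ∧ (letterIndex n a == k))) (allFin N))

  -- the term  β'^{|T|-|λ/μ|} x^{ω(T)}  specialised at x₁ = … = xₙ = β, β' = -β⁻¹:
  -- (-β⁻¹)^m · β^{ω₁+…+ωₙ} = (-1)^m β^{(ω₁+…+ωₙ) - m},  m = |T| - |λ/μ|
  specTerm : Filling n la mu → ℤ × ℤ
  specTerm T = signPow m , (+ xs ℤ.- + m)
    where
    m  = totalSize T ∸ skewSize la mu
    xs = sum (map (omega T) (map suc (upTo n)))

  GPspec : LPoly
  GPspec = map specTerm (filter (λ T → T? (isSSVT-P T)) allFillings)

  GQspec : LPoly
  GQspec = map specTerm (filter (λ T → T? (isSSVT-Q T)) allFillings)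

open Tab public using (isSSVT-P; isSSVT-Q; GPspec; GQspec)

βpow : ℤ → LPoly
βpow e = (+ 1 , e) ∷ []

{-# OPTIONS --safe #-}

-- At x₁ = … = xₙ = β and parameter −β⁻¹ a tableau T contributes (−1)^(|T| − |λ/μ|) β^|λ/μ|,
-- because its entries number |T| = ∑ₖ ωₖ(T).  So both identities say that the signed count
-- ∑_T (−1)^(|T| − |λ/μ|) over valid tableaux equals 1.  Call a letter a a candidate for box b
-- if it exceeds the least entry of b and may be added to or removed from b without breaking
-- conditions (1)–(4); this depends only on the vector of box minima, which toggling a
-- candidate leaves unchanged.  Toggling a candidate chosen from the minima is therefore a
-- sign-reversing involution.  Its fixed points are the valid fillings with one entry per box
-- and no candidate, and there is exactly one: a single-valued valid filling maximising the sum
-- of the minima is one, and the minima of two of them agree box by box, by induction from the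
-- bottom right corner.

module Submission where

open import Defs
open import Data.Bool using (Bool; true; false; not; _∧_; _∨_; T; if_then_else_)
open import Data.Bool.Properties using (T-∧; T-∨; T-≡; not-involutive)
import Data.Bool.Properties as Bool
open import Data.Bool.ListAction using (all; any)
open import Data.Empty using (⊥; ⊥-elim)
open import Data.Fin using (Fin; toℕ; zero; suc)
import Data.Fin.Properties as Fin
open import Data.Fin.Subset using (Subset; ⁅_⁆; ∣_∣) renaming (⊥ to ∅)
open import Data.Fin.Subset.Properties using (∣⊥∣≡0)
open import Data.Maybe using (Maybe; just; nothing)
open import Data.Integer using (ℤ; +_; -_; -[1+_])
import Data.Integer.Properties as ℤ
open import Data.List
  using (List; []; _∷_; _++_; length; map; concatMap; filter; allFin; upTo; applyUpTo; tabulate)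
import Data.List as List
import Data.List.Properties as Listₚ
open import Data.List.Extrema.Nat using (argmax; argmax-all; f[xs]≤f[argmax])
open import Data.List.Membership.Propositional using (_∈_)
open import Data.List.Membership.Propositional.Properties using (∈-map⁺; ∈-concat⁺′; ∈-upTo⁺; ∈-lookup; ∈-filter⁺)
open import Data.List.Relation.Unary.All as All using (All; _∷_)
import Data.List.Relation.Unary.All.Properties as Allₚ
open import Data.List.Relation.Unary.Any as Any using (here; there)
import Data.List.Relation.Unary.Any.Properties as Anyₚ
open import Data.List.Relation.Unary.Linked as Linked using (_∷_)
open import Data.Nat using (ℕ; zero; suc; _∸_; _≤_; _<_; _≤?_; _≡ᵇ_; _≤ᵇ_; z≤n; s≤s)
open import Data.Nat.DivMod using (_/_; m<n*o⇒m/o<n)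
open import Data.Nat.Induction using (<-wellFounded)
open import Data.Nat.ListAction using (sum)
import Data.Nat.Properties as ℕ
open import Data.Product using (_×_; _,_; proj₁; proj₂; ∃; uncurry)
open import Data.Product.Function.NonDependent.Propositional using (_×-⇔_)
open import Data.Sum using (_⊎_; inj₁; inj₂)
open import Data.Sum.Function.Propositional using (_⊎-⇔_)
open import Data.Vec as Vec using (Vec; []; _∷_; lookup; updateAt)
open import Data.Vec.Properties
  using (≡-dec; lookup-map; lookup∘updateAt; lookup∘updateAt′; map-updateAt; updateAt-id; updateAt-id-local;
         updateAt-updateAt; tabulate∘lookup)
import Data.Vec.Properties as Vecₚ
open import Function using (_∘_; id; _⇔_; mk⇔; Equivalence)
open import Function.Construct.Identity using (⇔-id)
open import Function.Properties.Equivalence using () renaming (trans to ⇔-trans)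
open import Function.Related.TypeIsomorphisms using (→-cong-⇔; ¬-cong-⇔)
open import Induction.WellFounded using (Acc; acc)
open import Relation.Binary.Definitions using (DecidableEquality; tri<; tri≈; tri>)
open import Relation.Binary.PropositionalEquality
  using (_≡_; _≢_; refl; sym; trans; cong; cong₂; subst; module ≡-Reasoning)
open import Relation.Nullary using (¬_; Dec; yes; no; does)
open import Relation.Nullary.Decidable using (T?; ¬?; map′; _×-dec_; _→-dec_)

open Equivalence using (to; from)

module BooleanReflection where

  T-not : ∀ {b} → T (not b) ⇔ (¬ T b)
  T-not {true}  = mk⇔ (λ ()) (λ ¬t → ¬t _)
  T-not {false} = mk⇔ (λ _ ()) (λ _ → _)

  T-unless : ∀ {a b} → T (a ∨ b) ⇔ (¬ T a → T b)
  T-unless {true}  = mk⇔ (λ _ ¬t → ⊥-elim (¬t _)) (λ _ → _)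
  T-unless {false} = mk⇔ (λ tb _ → tb) (λ f → f (λ ()))

  T-implies : ∀ {a b} → T (not a ∨ b) ⇔ (T a → T b)
  T-implies {true}  = mk⇔ (λ tb _ → tb) (λ f → f _)
  T-implies {false} = mk⇔ (λ _ ()) (λ _ → _)

  T-all-allFin : ∀ {k} {f : Fin k → Bool} → T (all f (allFin k)) ⇔ (∀ i → T (f i))
  T-all-allFin {f = f} = mk⇔ (Allₚ.tabulate⁻ ∘ Allₚ.all⁺ f _) (Allₚ.all⁻ f ∘ Allₚ.tabulate⁺)

  T-any-allFin : ∀ {k} {f : Fin k → Bool} → T (any f (allFin k)) ⇔ ∃ (T ∘ f)
  T-any-allFin {f = f} = mk⇔ (Anyₚ.tabulate⁻ ∘ Anyₚ.any⁻ f _) (Anyₚ.any⁺ f ∘ uncurry Anyₚ.tabulate⁺)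

module FiniteSums where
  open import Data.Integer using (_+_; _*_)
  open import Algebra.Properties.CommutativeSemigroup ℤ.+-commutativeSemigroup using (interchange)

  private variable A B : Set

  ∑ : List A → (A → ℤ) → ℤ
  ∑ []       f = + 0
  ∑ (x ∷ xs) f = f x + ∑ xs f

  infix 5 ∑
  syntax ∑ xs (λ x → e) = ∑[ x ∈ xs ] e

  𝟙 : Bool → ℤ
  𝟙 b = if b then + 1 else + 0

  𝟙-∧ : ∀ a b → 𝟙 (a ∧ b) ≡ 𝟙 a * 𝟙 b
  𝟙-∧ true  true  = refl
  𝟙-∧ true  false = refl
  𝟙-∧ false _     = refl

  ∑-cong : ∀ (xs : List A) {f g : A → ℤ} → (∀ x → f x ≡ g x) → ∑ xs f ≡ ∑ xs g
  ∑-cong []       f≗g = refl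
  ∑-cong (x ∷ xs) f≗g = cong₂ _+_ (f≗g x) (∑-cong xs f≗g)

  ∑-zero : ∀ (xs : List A) → ∑[ x ∈ xs ] + 0 ≡ + 0
  ∑-zero []       = refl
  ∑-zero (x ∷ xs) = trans (ℤ.+-identityˡ _) (∑-zero xs)

  ∑-distrib-+ : ∀ (xs : List A) f g → ∑[ x ∈ xs ] (f x + g x) ≡ ∑ xs f + ∑ xs g
  ∑-distrib-+ []       f g = refl
  ∑-distrib-+ (x ∷ xs) f g =
    trans (cong (_+_ (f x + g x)) (∑-distrib-+ xs f g)) (interchange (f x) (g x) _ _)

  ∑-*ˡ : ∀ (xs : List A) c f → ∑[ x ∈ xs ] (c * f x) ≡ c * ∑ xs f
  ∑-*ˡ []       c f = sym (ℤ.*-zeroʳ c)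
  ∑-*ˡ (x ∷ xs) c f =
    trans (cong (_+_ (c * f x)) (∑-*ˡ xs c f)) (sym (ℤ.*-distribˡ-+ c (f x) (∑ xs f)))

  ∑-neg : ∀ (xs : List A) f → ∑[ x ∈ xs ] (- f x) ≡ - ∑ xs f
  ∑-neg []       f = refl
  ∑-neg (x ∷ xs) f =
    trans (cong (_+_ (- f x)) (∑-neg xs f)) (sym (ℤ.neg-distrib-+ (f x) (∑ xs f)))

  ∑-++ : ∀ (xs ys : List A) f → ∑ (xs ++ ys) f ≡ ∑ xs f + ∑ ys f
  ∑-++ []       ys f = sym (ℤ.+-identityˡ _)
  ∑-++ (x ∷ xs) ys f = trans (cong (_+_ (f x)) (∑-++ xs ys f)) (sym (ℤ.+-assoc (f x) _ _))

  ∑-comm : ∀ (xs : List A) (ys : List B) (F : A → B → ℤ) →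
           ∑[ x ∈ xs ] ∑[ y ∈ ys ] F x y ≡ ∑[ y ∈ ys ] ∑[ x ∈ xs ] F x y
  ∑-comm []       ys F = sym (∑-zero ys)
  ∑-comm (x ∷ xs) ys F =
    trans (cong (_+_ (∑ ys (F x))) (∑-comm xs ys F))
          (sym (∑-distrib-+ ys (F x) (λ y → ∑[ x ∈ xs ] F x y)))

  ∑-map : ∀ (h : B → A) (ys : List B) f → ∑ (map h ys) f ≡ ∑[ y ∈ ys ] f (h y)
  ∑-map h []       f = refl
  ∑-map h (y ∷ ys) f = cong (_+_ (f (h y))) (∑-map h ys f)

  ∑-concatMap : ∀ (h : B → List A) (ys : List B) f →
                ∑ (concatMap h ys) f ≡ ∑[ y ∈ ys ] ∑ (h y) f
  ∑-concatMap h []       f = refl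
  ∑-concatMap h (y ∷ ys) f =
    trans (∑-++ (h y) (concatMap h ys) f) (cong (_+_ (∑ (h y) f)) (∑-concatMap h ys f))

  pos-sum : ∀ (xs : List A) (f : A → ℕ) → + sum (map f xs) ≡ ∑[ x ∈ xs ] + f x
  pos-sum []       f = refl
  pos-sum (x ∷ xs) f = trans (ℤ.pos-+ (f x) _) (cong (_+_ (+ f x)) (pos-sum xs f))

  pos-length-filter : ∀ (xs : List A) (f : A → Bool) →
                      + length (filter (T? ∘ f) xs) ≡ ∑[ x ∈ xs ] 𝟙 (f x)
  pos-length-filter []       f = refl
  pos-length-filter (x ∷ xs) f with f x
  ... | true  = trans (ℤ.pos-+ 1 _) (cong (_+_ (+ 1)) (pos-length-filter xs f))
  ... | false = trans (pos-length-filter xs f) (sym (ℤ.+-identityˡ _))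

  ∑-applyUpTo-suc : ∀ n f → ∑ (applyUpTo suc n) f ≡ ∑[ j ∈ upTo n ] f (suc j)
  ∑-applyUpTo-suc n f = trans (cong (λ js → ∑ js f) (sym (Listₚ.map-upTo suc n))) (∑-map suc (upTo n) f)

  ∑-upTo-𝟙 : ∀ {n q} → q < n → ∑[ j ∈ upTo n ] 𝟙 (q ≡ᵇ j) ≡ + 1
  ∑-upTo-𝟙 {suc n} {zero}  _         = cong (_+_ (+ 1)) (trans (∑-applyUpTo-suc n _) (∑-zero (upTo n)))
  ∑-upTo-𝟙 {suc n} {suc q} (s≤s q<n) =
    trans (ℤ.+-identityˡ _) (trans (∑-applyUpTo-suc n _) (∑-upTo-𝟙 q<n))

module Enumerations where
  open import Data.Integer using (_*_)
  open FiniteSums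

  IsEnumeration : ∀ {A : Set} → DecidableEquality A → List A → Set
  IsEnumeration _≟_ xs = ∀ z → ∑[ x ∈ xs ] 𝟙 (does (z ≟ x)) ≡ + 1

  allVecs-isEnumeration : ∀ {A : Set} {_≟_ : DecidableEquality A} {xs} →
                          IsEnumeration _≟_ xs → ∀ m → IsEnumeration (≡-dec _≟_) (allVecs xs m)
  allVecs-isEnumeration enum zero    []      = refl
  allVecs-isEnumeration {_≟_ = _≟_} {xs} enum (suc m) (z ∷ w) = begin
    ∑ (concatMap (λ x → map (x ∷_) (allVecs xs m)) xs) (λ v → 𝟙 (does (≡-dec _≟_ (z ∷ w) v)))
      ≡⟨ ∑-concatMap _ xs _ ⟩
    ∑[ x ∈ xs ] ∑ (map (x ∷_) (allVecs xs m)) (λ v → 𝟙 (does (≡-dec _≟_ (z ∷ w) v)))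
      ≡⟨ ∑-cong xs (λ x → ∑-map (x ∷_) (allVecs xs m) _) ⟩
    ∑[ x ∈ xs ] ∑[ v ∈ allVecs xs m ] 𝟙 (does (z ≟ x) ∧ does (≡-dec _≟_ w v))
      ≡⟨ ∑-cong xs (λ x → ∑-cong (allVecs xs m) (λ v → 𝟙-∧ (does (z ≟ x)) _)) ⟩
    ∑[ x ∈ xs ] ∑[ v ∈ allVecs xs m ] 𝟙 (does (z ≟ x)) * 𝟙 (does (≡-dec _≟_ w v))
      ≡⟨ ∑-cong xs (λ x → ∑-*ˡ (allVecs xs m) (𝟙 (does (z ≟ x))) (λ v → 𝟙 (does (≡-dec _≟_ w v)))) ⟩
    ∑[ x ∈ xs ] 𝟙 (does (z ≟ x)) * (∑[ v ∈ allVecs xs m ] 𝟙 (does (≡-dec _≟_ w v)))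
      ≡⟨ ∑-cong xs (λ x → cong (𝟙 (does (z ≟ x)) *_) (allVecs-isEnumeration enum m w)) ⟩
    ∑[ x ∈ xs ] 𝟙 (does (z ≟ x)) * + 1
      ≡⟨ ∑-cong xs (λ x → ℤ.*-identityʳ _) ⟩
    ∑[ x ∈ xs ] 𝟙 (does (z ≟ x))
      ≡⟨ enum z ⟩
    + 1 ∎
    where open ≡-Reasoning

  enumeration-∈ : ∀ {A : Set} {_≟_ : DecidableEquality A} {xs} → IsEnumeration _≟_ xs → ∀ z → z ∈ xs
  enumeration-∈ {_≟_ = _≟_} enum z = once⇒∈ _ (enum z)
    where
    once⇒∈ : ∀ xs → ∑[ x ∈ xs ] 𝟙 (does (z ≟ x)) ≡ + 1 → z ∈ xs
    once⇒∈ []       ()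
    once⇒∈ (x ∷ xs) once with z ≟ x
    ... | yes refl = here refl
    ... | no _     = there (once⇒∈ xs (trans (sym (ℤ.+-identityˡ _)) once))

module SignReversingInvolutions where
  open import Data.Integer using (_+_; _*_)
  open FiniteSums
  open Enumerations

  self-negating : ∀ s → s ≡ - s → s ≡ + 0
  self-negating (+ zero)   _  = refl
  self-negating (+ suc _)  ()
  self-negating -[1+ _ ]   ()

  module _ {A : Set} (_≟_ : DecidableEquality A) (U : List A) (enum : IsEnumeration _≟_ U)
           (ι : A → A) (ι-involutive : ∀ x → ι (ι x) ≡ x) where

    private
      transpose : ∀ (g : A → ℤ) x y → g (ι x) * 𝟙 (does (ι x ≟ y)) ≡ g y * 𝟙 (does (ι y ≟ x))
      transpose g x y with ι x ≟ y | ι y ≟ x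
      ... | yes refl | yes _    = refl
      ... | yes refl | no ιy≢x  = ⊥-elim (ιy≢x (ι-involutive x))
      ... | no ιx≢y  | yes refl = ⊥-elim (ιx≢y (ι-involutive y))
      ... | no _     | no _     = trans (ℤ.*-zeroʳ (g (ι x))) (sym (ℤ.*-zeroʳ (g y)))

    ∑-reindex : ∀ g → ∑[ x ∈ U ] g (ι x) ≡ ∑ U g
    ∑-reindex g = begin
      ∑[ x ∈ U ] g (ι x)
        ≡⟨ ∑-cong U (λ x → sym (ℤ.*-identityʳ _)) ⟩
      ∑[ x ∈ U ] g (ι x) * + 1
        ≡⟨ ∑-cong U (λ x → cong (g (ι x) *_) (sym (enum (ι x)))) ⟩
      ∑[ x ∈ U ] g (ι x) * (∑[ y ∈ U ] 𝟙 (does (ι x ≟ y)))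
        ≡⟨ ∑-cong U (λ x → sym (∑-*ˡ U (g (ι x)) (λ y → 𝟙 (does (ι x ≟ y))))) ⟩
      ∑[ x ∈ U ] ∑[ y ∈ U ] g (ι x) * 𝟙 (does (ι x ≟ y))
        ≡⟨ ∑-cong U (λ x → ∑-cong U (transpose g x)) ⟩
      ∑[ x ∈ U ] ∑[ y ∈ U ] g y * 𝟙 (does (ι y ≟ x))
        ≡⟨ ∑-comm U U (λ x y → g y * 𝟙 (does (ι y ≟ x))) ⟩
      ∑[ y ∈ U ] ∑[ x ∈ U ] g y * 𝟙 (does (ι y ≟ x))
        ≡⟨ ∑-cong U (λ y → ∑-*ˡ U (g y) (λ x → 𝟙 (does (ι y ≟ x)))) ⟩
      ∑[ y ∈ U ] g y * (∑[ x ∈ U ] 𝟙 (does (ι y ≟ x)))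
        ≡⟨ ∑-cong U (λ y → cong (g y *_) (enum (ι y))) ⟩
      ∑[ y ∈ U ] g y * + 1
        ≡⟨ ∑-cong U (λ y → ℤ.*-identityʳ _) ⟩
      ∑ U g
        ∎
      where open ≡-Reasoning

    ∑-signReversing : ∀ (h : A → ℤ) f → ι f ≡ f → (∀ x → x ≢ f → h (ι x) ≡ - h x) → ∑ U h ≡ h f
    ∑-signReversing h f ιf≡f h-flips = begin
      ∑ U h                                           ≡⟨ ∑-cong U split ⟩
      ∑[ x ∈ U ] (h f * 𝟙 (does (f ≟ x)) + h′ x)      ≡⟨ ∑-distrib-+ U _ h′ ⟩
      (∑[ x ∈ U ] h f * 𝟙 (does (f ≟ x))) + ∑ U h′   ≡⟨ cong₂ _+_ (∑-*ˡ U (h f) _) ∑h′≡0 ⟩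
      h f * (∑[ x ∈ U ] 𝟙 (does (f ≟ x))) + + 0      ≡⟨ cong (λ c → h f * c + + 0) (enum f) ⟩
      h f * + 1 + + 0                                 ≡⟨ trans (ℤ.+-identityʳ _) (ℤ.*-identityʳ _) ⟩
      h f                                             ∎
      where
      open ≡-Reasoning

      h′ : A → ℤ
      h′ x with f ≟ x
      ... | yes _ = + 0
      ... | no  _ = h x

      split : ∀ x → h x ≡ h f * 𝟙 (does (f ≟ x)) + h′ x
      split x with f ≟ x
      ... | yes refl = sym (trans (ℤ.+-identityʳ _) (ℤ.*-identityʳ _))
      ... | no  _    = sym (trans (cong (_+ h x) (ℤ.*-zeroʳ (h f))) (ℤ.+-identityˡ _))

      h′-flips : ∀ x → h′ (ι x) ≡ - h′ x
      h′-flips x with f ≟ x | f ≟ ι x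
      ... | yes refl | yes _     = refl
      ... | yes refl | no f≢ιf   = ⊥-elim (f≢ιf (sym ιf≡f))
      ... | no f≢x   | yes f≡ιx  = ⊥-elim (f≢x (trans (sym ιf≡f) (trans (cong ι f≡ιx) (ι-involutive x))))
      ... | no f≢x   | no _      = h-flips x (f≢x ∘ sym)

      ∑h′≡0 : ∑ U h′ ≡ + 0
      ∑h′≡0 = self-negating _ (trans (sym (∑-reindex h′)) (trans (∑-cong U h′-flips) (∑-neg U h′)))

module SubsetVectors where
  open import Data.Nat using (_+_)

  private variable k : ℕ

  least : Subset k → ℕ
  least []          = 0
  least (true  ∷ _) = 0
  least (false ∷ S) = suc (least S)

  least-≤ : ∀ (S : Subset k) x → T (lookup S x) → least S ≤ toℕ x
  least-≤ (true  ∷ S) x       _   = z≤n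
  least-≤ (false ∷ S) (suc x) x∈S = s≤s (least-≤ S x x∈S)

  least-∈ : ∀ (S : Subset k) x → T (lookup S x) → ∃ λ y → T (lookup S y) × toℕ y ≡ least S
  least-∈ (true  ∷ S) x       _   = zero , _ , refl
  least-∈ (false ∷ S) (suc x) x∈S with least-∈ S x x∈S
  ... | y , y∈S , y≡least = suc y , y∈S , cong suc y≡least

  toggle : Subset k → Fin k → Subset k
  toggle S x = updateAt S x not

  toggle-involutive : ∀ (S : Subset k) x → toggle (toggle S x) x ≡ S
  toggle-involutive S x = trans (updateAt-updateAt x S) (updateAt-id-local x S (not-involutive _))

  least-toggle : ∀ (S : Subset k) x → least S < toℕ x → least (toggle S x) ≡ least S
  least-toggle (true  ∷ S) (suc x) _        = refl
  least-toggle (false ∷ S) (suc x) (s≤s lt) = cong suc (least-toggle S x lt)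

  ∣toggle∣ : ∀ (S : Subset k) x → ¬ T (lookup S x) → ∣ toggle S x ∣ ≡ suc ∣ S ∣
  ∣toggle∣ (false ∷ S) zero    _   = refl
  ∣toggle∣ (true  ∷ S) (suc x) x∉S = cong suc (∣toggle∣ S x x∉S)
  ∣toggle∣ (false ∷ S) (suc x) x∉S = ∣toggle∣ S x x∉S
  ∣toggle∣ (true  ∷ S) zero    x∉S = ⊥-elim (x∉S _)

  keepLeast : Subset k → Subset k
  keepLeast []          = []
  keepLeast (true  ∷ S) = true ∷ ∅
  keepLeast (false ∷ S) = false ∷ keepLeast S

  ∉∅ : ∀ {k} (x : Fin k) → ¬ T (lookup ∅ x)
  ∉∅ (suc x) = ∉∅ x

  keepLeast-⊆ : ∀ (S : Subset k) x → T (lookup (keepLeast S) x) → T (lookup S x)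
  keepLeast-⊆ (true  ∷ S) zero    _   = _
  keepLeast-⊆ (true  ∷ S) (suc x) x∈∅ = ⊥-elim (∉∅ x x∈∅)
  keepLeast-⊆ (false ∷ S) (suc x) x∈S = keepLeast-⊆ S x x∈S

  keepLeast-least : ∀ (S : Subset k) x → T (lookup (keepLeast S) x) → toℕ x ≡ least S
  keepLeast-least (true  ∷ S) zero    _   = refl
  keepLeast-least (true  ∷ S) (suc x) x∈∅ = ⊥-elim (∉∅ x x∈∅)
  keepLeast-least (false ∷ S) (suc x) x∈S = cong suc (keepLeast-least S x x∈S)

  keepLeast-nonempty : ∀ (S : Subset k) x → T (lookup S x) → ∃ (T ∘ lookup (keepLeast S))
  keepLeast-nonempty (true  ∷ S) x       _   = zero , _
  keepLeast-nonempty (false ∷ S) (suc x) x∈S with keepLeast-nonempty S x x∈S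
  ... | y , y∈ = suc y , y∈

  ∣keepLeast∣ : ∀ (S : Subset k) x → T (lookup S x) → ∣ keepLeast S ∣ ≡ 1
  ∣keepLeast∣ {suc k} (true  ∷ S) x       _   = cong suc (∣⊥∣≡0 k)
  ∣keepLeast∣         (false ∷ S) (suc x) x∈S = ∣keepLeast∣ S x x∈S

  keepLeast-idempotent : ∀ (S : Subset k) → keepLeast (keepLeast S) ≡ keepLeast S
  keepLeast-idempotent []          = refl
  keepLeast-idempotent (true  ∷ S) = refl
  keepLeast-idempotent (false ∷ S) = cong (false ∷_) (keepLeast-idempotent S)

  ∅-unique : ∀ (S : Subset k) → (∀ x → ¬ T (lookup S x)) → S ≡ ∅
  ∅-unique []          _     = refl
  ∅-unique (true  ∷ S) empty = ⊥-elim (empty zero _)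
  ∅-unique (false ∷ S) empty = cong (false ∷_) (∅-unique S (empty ∘ suc))

  keepLeast-id : ∀ (S : Subset k) → (∀ x → T (lookup S x) → toℕ x ≡ least S) → keepLeast S ≡ S
  keepLeast-id []          _    = refl
  keepLeast-id (true  ∷ S) only = cong (true ∷_) (sym (∅-unique S (λ x → ℕ.1+n≢0 ∘ only (suc x))))
  keepLeast-id (false ∷ S) only = cong (false ∷_) (keepLeast-id S (λ x → ℕ.suc-injective ∘ only (suc x)))

  keepLeast-cong : ∀ (S S′ : Subset k) {x y} → T (lookup S x) → T (lookup S′ y) →
                   least S ≡ least S′ → keepLeast S ≡ keepLeast S′
  keepLeast-cong (true  ∷ S) (true  ∷ S′) _ _ _ = refl
  keepLeast-cong (false ∷ S) (false ∷ S′) {suc x} {suc y} x∈S y∈S′ eq =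
    cong (false ∷_) (keepLeast-cong S S′ x∈S y∈S′ (ℕ.suc-injective eq))
  keepLeast-cong (true  ∷ S) (false ∷ S′) _ _ ()
  keepLeast-cong (false ∷ S) (true  ∷ S′) _ _ ()

  least-⁅⁆ : ∀ (x : Fin k) → least ⁅ x ⁆ ≡ toℕ x
  least-⁅⁆ zero    = refl
  least-⁅⁆ (suc x) = cong suc (least-⁅⁆ x)

  keepLeast-⁅⁆ : ∀ (x : Fin k) → keepLeast ⁅ x ⁆ ≡ ⁅ x ⁆
  keepLeast-⁅⁆ zero    = refl
  keepLeast-⁅⁆ (suc x) = cong (false ∷_) (keepLeast-⁅⁆ x)

  ⁅⁆-∋ : ∀ (x : Fin k) → T (lookup ⁅ x ⁆ x)
  ⁅⁆-∋ zero    = _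
  ⁅⁆-∋ (suc x) = ⁅⁆-∋ x

  ∈⁅⁆ : ∀ (x y : Fin k) → T (lookup ⁅ x ⁆ y) → y ≡ x
  ∈⁅⁆ zero    zero    _   = refl
  ∈⁅⁆ zero    (suc y) y∈∅ = ⊥-elim (∉∅ y y∈∅)
  ∈⁅⁆ (suc x) (suc y) y∈x = cong suc (∈⁅⁆ x y y∈x)

  ∣∣-pos : ∀ (S : Subset k) x → T (lookup S x) → 1 ≤ ∣ S ∣
  ∣∣-pos (true  ∷ S) x       _   = s≤s z≤n
  ∣∣-pos (false ∷ S) (suc x) x∈S = ∣∣-pos S x x∈S

  ∥_∥ : ∀ {m} → Vec (Subset k) m → ℕ
  ∥ []    ∥ = 0
  ∥ S ∷ F ∥ = ∣ S ∣ + ∥ F ∥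

  ∥updateAt∥ : ∀ {m} (F : Vec (Subset k) m) i {g} → ∣ g (lookup F i) ∣ ≡ suc ∣ lookup F i ∣ →
               ∥ updateAt F i g ∥ ≡ suc ∥ F ∥
  ∥updateAt∥ (S ∷ F) zero    grows = cong (_+ ∥ F ∥) grows
  ∥updateAt∥ (S ∷ F) (suc i) grows = trans (cong (_+_ ∣ S ∣) (∥updateAt∥ F i grows)) (ℕ.+-suc ∣ S ∣ ∥ F ∥)

  ∥∥-≥ : ∀ {m} (F : Vec (Subset k) m) → (∀ i → 1 ≤ ∣ lookup F i ∣) → m ≤ ∥ F ∥
  ∥∥-≥ []      _   = z≤n
  ∥∥-≥ (S ∷ F) pos = ℕ.+-mono-≤ (pos zero) (∥∥-≥ F (pos ∘ suc))

  ∥∥-≡ : ∀ {m} (F : Vec (Subset k) m) → (∀ i → ∣ lookup F i ∣ ≡ 1) → ∥ F ∥ ≡ m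
  ∥∥-≡ []      _   = refl
  ∥∥-≡ (S ∷ F) one = cong₂ _+_ (one zero) (∥∥-≡ F (one ∘ suc))

  sum-tabulate-∣∣ : ∀ {m} (F : Vec (Subset k) m) → sum (tabulate (∣_∣ ∘ lookup F)) ≡ ∥ F ∥
  sum-tabulate-∣∣ []      = refl
  sum-tabulate-∣∣ (S ∷ F) = cong (_+_ ∣ S ∣) (sum-tabulate-∣∣ F)

  count-tabulate : ∀ {A : Set} (f : A → Bool) (g : Fin k → A) →
                   length (filter (T? ∘ f) (tabulate g)) ≡ ∣ Vec.tabulate (f ∘ g) ∣
  count-tabulate {zero}  f g = refl
  count-tabulate {suc k} f g with f (g zero)
  ... | true  = cong suc (count-tabulate f (g ∘ suc))
  ... | false = count-tabulate f (g ∘ suc)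

  count-lookup : ∀ (S : Subset k) → length (filter (T? ∘ lookup S) (allFin k)) ≡ ∣ S ∣
  count-lookup S = trans (count-tabulate (lookup S) id) (cong ∣_∣ (tabulate∘lookup S))

module StrictPartitions where
  open import Data.Nat using (_+_)

  part-beyond : ∀ p {i} → length p < i → part p i ≡ 0
  part-beyond []       _                    = refl
  part-beyond (x ∷ xs) {suc (suc i)} (s≤s lt) = part-beyond xs lt
  part-beyond (x ∷ xs) {suc zero} (s≤s ())

  part-pos : ∀ {p} → IsStrictPartition p → ∀ i → suc i ≤ length p → 0 < part p (suc i)
  part-pos {x ∷ xs} (x>0 ∷ _ , _) zero _ = x>0
  part-pos {x ∷ xs} (_ ∷ pos , linked) (suc i) (s≤s le) = part-pos (pos , Linked.tail linked) i le

  part-step : ∀ {p} → IsStrictPartition p → ∀ i → suc (suc i) ≤ length p →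
              part p (suc (suc i)) < part p (suc i)
  part-step {x ∷ y ∷ xs} (_ , y<x ∷ _) zero _ = y<x
  part-step {x ∷ y ∷ xs} (_ ∷ pos , _ ∷ linked) (suc i) (s≤s le) = part-step (pos , linked) i le
  part-step {x ∷ []} _ zero    (s≤s ())
  part-step {x ∷ []} _ (suc i) (s≤s ())

  part-next : ∀ {p} → IsStrictPartition p → ∀ i →
              part p (suc (suc i)) ≡ 0 ⊎ part p (suc (suc i)) < part p (suc i)
  part-next {p} sp i with suc (suc i) ≤? length p
  ... | yes le = inj₂ (part-step sp i le)
  ... | no  gt = inj₁ (part-beyond p (ℕ.≰⇒> gt))

  part+index-antitone : ∀ {p} → IsStrictPartition p → ∀ {i i′} → i ≤ i′ → suc i′ ≤ length p →
                        part p (suc i′) + suc i′ ≤ part p (suc i) + suc i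
  part+index-antitone sp {i} {i′} i≤i′ le with ℕ.m≤n⇒m<n∨m≡n i≤i′
  ... | inj₂ refl = ℕ.≤-refl
  part+index-antitone {p} sp {i} {suc j} _ le | inj₁ (s≤s i≤j) =
    ℕ.≤-trans (ℕ.≤-reflexive (ℕ.+-suc (part p (suc (suc j))) (suc j)))
      (ℕ.≤-trans (ℕ.+-monoˡ-≤ (suc j) (part-step sp j le))
        (part+index-antitone sp i≤j (ℕ.<⇒≤ le)))

  length-⊇ : ∀ {la mu} → IsStrictPartition mu → la ⊇ mu → length mu ≤ length la
  length-⊇ {la} {mu} sp-mu la⊇mu with length mu ≤? length la
  ... | yes le = le
  ... | no  gt = ⊥-elim (ℕ.<-irrefl refl (ℕ.<-≤-trans (part-pos sp-mu (length la) (ℕ.≰⇒> gt))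
                   (ℕ.≤-trans (la⊇mu (suc (length la))) (ℕ.≤-reflexive (part-beyond la ℕ.≤-refl)))))

  sum-parts : ∀ p {L} → length p ≤ L → sum (applyUpTo (part p ∘ suc) L) ≡ sum p
  sum-parts []       {zero}  _        = refl
  sum-parts []       {suc L} _        = sum-parts [] {L} z≤n
  sum-parts (x ∷ xs) {suc L} (s≤s le) = cong (_+_ x) (sum-parts xs le)

module ShiftedDiagram {la mu : List ℕ} (sp-la : IsStrictPartition la) (sp-mu : IsStrictPartition mu)
                      (la⊇mu : la ⊇ mu) where
  open StrictPartitions
  open import Data.Nat using (_+_; _*_)
  open import Algebra.Properties.CommutativeSemigroup ℕ.+-commutativeSemigroup using (interchange)

  Pos : Set
  Pos = Fin (length (boxes la mu))

  row col : Pos → ℕ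
  row p = proj₁ (List.lookup (boxes la mu) p)
  col p = proj₂ (List.lookup (boxes la mu) p)

  record InDiagram (i j : ℕ) : Set where
    field
      row≥1     : 1 ≤ i
      row≤ℓ     : i ≤ length la
      start≤col : part mu i + i ≤ j
      col<end   : j < part la i + i

  private
    rowBoxes : ℕ → List (ℕ × ℕ)
    rowBoxes i = map (λ k → (i , part mu i + i + k)) (upTo (part la i ∸ part mu i))

    offset<width : ∀ {a b c k} → b ≤ a → k < a ∸ b → b + c + k < a + c
    offset<width {a} {b} {c} {k} b≤a k<a∸b = begin-strict
      b + c + k       ≡⟨ ℕ.+-assoc b c k ⟩
      b + (c + k)     ≡⟨ cong (_+_ b) (ℕ.+-comm c k) ⟩
      b + (k + c)     ≡⟨ ℕ.+-assoc b k c ⟨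
      b + k + c       <⟨ ℕ.+-monoˡ-< c (ℕ.+-monoʳ-< b k<a∸b) ⟩
      b + (a ∸ b) + c ≡⟨ cong (_+ c) (ℕ.m+[n∸m]≡n b≤a) ⟩
      a + c           ∎
      where open ℕ.≤-Reasoning

  boxes-sound : All (uncurry InDiagram) (boxes la mu)
  boxes-sound = Allₚ.concat⁺ (Allₚ.map⁺ (Allₚ.map⁺ (Allₚ.applyUpTo⁺₁ id (length la) λ {i} i<ℓ →
    Allₚ.map⁺ (Allₚ.applyUpTo⁺₁ id _ λ {k} k<width → record
      { row≥1     = s≤s z≤n
      ; row≤ℓ     = i<ℓ
      ; start≤col = ℕ.m≤m+n _ k
      ; col<end   = offset<width (la⊇mu (suc i)) k<width
      }))))

  inDiagram : ∀ p → InDiagram (row p) (col p)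
  inDiagram p = All.lookup boxes-sound (∈-lookup p)

  boxes-complete : ∀ {i j} → InDiagram i j → (i , j) ∈ boxes la mu
  boxes-complete {zero}  record { row≥1 = () }
  boxes-complete {suc r} {j} d =
    ∈-concat⁺′ (subst (λ c → (suc r , c) ∈ rowBoxes (suc r)) (ℕ.m+[n∸m]≡n start≤col)
                  (∈-map⁺ _ (∈-upTo⁺ offset<)))
               (∈-map⁺ rowBoxes (∈-map⁺ suc (∈-upTo⁺ row≤ℓ)))
    where
    open InDiagram d
    start = part mu (suc r) + suc r
    offset< : j ∸ start < part la (suc r) ∸ part mu (suc r)
    offset< = subst (j ∸ start <_)
      (trans (cong₂ _∸_ (ℕ.+-comm (part la (suc r)) (suc r)) (ℕ.+-comm (part mu (suc r)) (suc r)))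
             (ℕ.[m+n]∸[m+o]≡n∸o (suc r) _ _))
      (ℕ.∸-monoˡ-< col<end start≤col)

  position : ∀ {i j} → InDiagram i j → ∃ λ p → row p ≡ i × col p ≡ j
  position d = Any.index ij∈boxes , cong proj₁ (sym box≡ij) , cong proj₂ (sym box≡ij)
    where
    ij∈boxes = boxes-complete d
    box≡ij = Anyₚ.lookup-index ij∈boxes

  inDiagram-right : ∀ {i j j′} → InDiagram i j → InDiagram i j′ → j < j′ → InDiagram i (suc j)
  inDiagram-right d d′ j<j′ = record
    { row≥1     = row≥1 d
    ; row≤ℓ     = row≤ℓ d
    ; start≤col = ℕ.m≤n⇒m≤1+n (start≤col d)
    ; col<end   = ℕ.≤-<-trans j<j′ (col<end d′)
    }
    where open InDiagram

  inDiagram-down : ∀ {i i′ j} → InDiagram i j → InDiagram i′ j → i < i′ → InDiagram (suc i) j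
  inDiagram-down {suc r} {i′} {j} d d′ i<i′ = record
    { row≥1     = s≤s z≤n
    ; row≤ℓ     = ℕ.≤-trans i<i′ (row≤ℓ d′)
    ; start≤col = start≤col′ (part-next sp-mu r)
    ; col<end   = ℕ.<-≤-trans (col<end d′) (end-antitone i<i′ (row≤ℓ d′))
    }
    where
    open InDiagram
    start≤col′ : _ → part mu (suc (suc r)) + suc (suc r) ≤ j
    start≤col′ (inj₁ μ≡0) = ℕ.≤-trans (ℕ.≤-reflexive (cong (_+ suc (suc r)) μ≡0))
                                (ℕ.≤-trans i<i′ (ℕ.≤-trans (ℕ.m≤n+m i′ _) (start≤col d′)))
    start≤col′ (inj₂ μ<) = ℕ.≤-trans (ℕ.≤-reflexive (ℕ.+-suc _ (suc r)))
                                (ℕ.≤-trans (ℕ.+-monoˡ-≤ (suc r) μ<) (start≤col d))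
    end-antitone : ∀ {i′} → suc r < i′ → i′ ≤ length la → part la i′ + i′ ≤ part la (suc (suc r)) + suc (suc r)
    end-antitone {suc r′} (s≤s r<r′) le = part+index-antitone sp-la r<r′ le
  inDiagram-down {zero} record { row≥1 = () }

  right-neighbour : ∀ p q → row p ≡ row q → col p < col q →
                    ∃ λ r → row r ≡ row p × col r ≡ suc (col p)
  right-neighbour p q rp≡rq lt =
    position (inDiagram-right (inDiagram p) (subst (λ i → InDiagram i (col q)) (sym rp≡rq) (inDiagram q)) lt)

  lower-neighbour : ∀ p q → col p ≡ col q → row p < row q →
                    ∃ λ r → col r ≡ col p × row r ≡ suc (row p)
  lower-neighbour p q cp≡cq lt
    with position (inDiagram-down (inDiagram p) (subst (InDiagram (row q)) (sym cp≡cq) (inDiagram q)) lt)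
  ... | r , rr≡ , cr≡ = r , cr≡ , rr≡

  length-boxes : length (boxes la mu) ≡ skewSize la mu
  length-boxes = begin
    length (boxes la mu)                              ≡⟨ length-concatMap rowBoxes (map suc (upTo ℓ)) ⟩
    sum (map (length ∘ rowBoxes) (map suc (upTo ℓ)))  ≡⟨ cong sum (Listₚ.map-∘ (upTo ℓ)) ⟨
    sum (map (length ∘ rowBoxes ∘ suc) (upTo ℓ))      ≡⟨ cong sum (Listₚ.map-cong rowBoxes-length (upTo ℓ)) ⟩
    sum (map width (upTo ℓ))                          ≡⟨ cong sum (Listₚ.map-upTo width ℓ) ⟩
    sum (applyUpTo width ℓ)                           ≡⟨ ℕ.m+n∸n≡m _ (size mu) ⟨
    sum (applyUpTo width ℓ) + size mu ∸ size mu       ≡⟨ cong (_∸ size mu) widths+size≡size ⟩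
    size la ∸ size mu                                 ∎
    where
    open ≡-Reasoning
    ℓ = length la
    width : ℕ → ℕ
    width i = part la (suc i) ∸ part mu (suc i)

    length-concatMap : ∀ {A B : Set} (f : A → List B) xs → length (concatMap f xs) ≡ sum (map (length ∘ f) xs)
    length-concatMap f []       = refl
    length-concatMap f (x ∷ xs) = trans (Listₚ.length-++ (f x)) (cong (_+_ (length (f x))) (length-concatMap f xs))

    rowBoxes-length : ∀ i → length (rowBoxes (suc i)) ≡ width i
    rowBoxes-length i = trans (Listₚ.length-map _ (upTo (width i))) (Listₚ.length-applyUpTo id (width i))

    sum-∸ : ∀ (a b : ℕ → ℕ) L → (∀ i → b i ≤ a i) →
            sum (applyUpTo (λ i → a i ∸ b i) L) + sum (applyUpTo b L) ≡ sum (applyUpTo a L)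
    sum-∸ a b zero    _   = refl
    sum-∸ a b (suc L) b≤a = trans (interchange (a 0 ∸ b 0) _ (b 0) _)
      (cong₂ _+_ (ℕ.m∸n+n≡m (b≤a 0)) (sum-∸ (a ∘ suc) (b ∘ suc) L (b≤a ∘ suc)))

    widths+size≡size : sum (applyUpTo width ℓ) + size mu ≡ size la
    widths+size≡size = begin
      sum (applyUpTo width ℓ) + size mu
        ≡⟨ cong (_+_ (sum (applyUpTo width ℓ))) (sum-parts mu (length-⊇ {la} sp-mu la⊇mu)) ⟨
      sum (applyUpTo width ℓ) + sum (applyUpTo (part mu ∘ suc) ℓ)
        ≡⟨ sum-∸ (part la ∘ suc) (part mu ∘ suc) ℓ (la⊇mu ∘ suc) ⟩
      sum (applyUpTo (part la ∘ suc) ℓ)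
        ≡⟨ sum-parts la ℕ.≤-refl ⟩
      size la
        ∎

  bound : ℕ
  bound = part la 1 + 1 + length la

  row≤bound : ∀ p → row p ≤ bound
  row≤bound p = ℕ.≤-trans (InDiagram.row≤ℓ (inDiagram p)) (ℕ.m≤n+m _ _)

  col≤bound : ∀ p → col p ≤ bound
  col≤bound p = ℕ.≤-trans (ℕ.<⇒≤ (col<first-end (inDiagram p))) (ℕ.m≤m+n _ _)
    where
    col<first-end : ∀ {i j} → InDiagram i j → j < part la 1 + 1
    col<first-end {zero}  record { row≥1 = () }
    col<first-end {suc r} d = ℕ.<-≤-trans (InDiagram.col<end d) (part+index-antitone sp-la z≤n (InDiagram.row≤ℓ d))

  rank : Pos → ℕ
  rank p = (bound ∸ row p) * suc bound + (bound ∸ col p)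

  rank-right : ∀ b q → row q ≡ row b → col b < col q → rank q < rank b
  rank-right b q rq≡rb cb<cq rewrite rq≡rb =
    ℕ.+-monoʳ-< ((bound ∸ row b) * suc bound) (ℕ.∸-monoʳ-< cb<cq (col≤bound q))

  rank-down : ∀ b q → row b < row q → rank q < rank b
  rank-down b q rb<rq = begin-strict
    (bound ∸ row q) * suc bound + (bound ∸ col q) <⟨ ℕ.+-monoʳ-< _ (s≤s (ℕ.m∸n≤m bound (col q))) ⟩
    (bound ∸ row q) * suc bound + suc bound       ≡⟨ ℕ.+-comm _ (suc bound) ⟩
    suc (bound ∸ row q) * suc bound               ≤⟨ ℕ.*-monoˡ-≤ (suc bound) (ℕ.∸-monoʳ-< rb<rq (row≤bound q)) ⟩
    (bound ∸ row b) * suc bound                   ≤⟨ ℕ.m≤m+n _ _ ⟩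
    rank b                                        ∎
    where open ℕ.≤-Reasoning

data Kind : Set where
  P Q : Kind


module Fillings (n : ℕ) {la mu : List ℕ} (sp-la : IsStrictPartition la) (sp-mu : IsStrictPartition mu)
                (la⊇mu : la ⊇ mu) where
  open ShiftedDiagram sp-la sp-mu la⊇mu public
  open import Data.Nat using (_+_; _*_)
  open BooleanReflection
  open Enumerations
  open Tab n la mu using (nonemptyBoxes; maxLeMin; cond1; cond2; cond3; cond4)

  isValid : Kind → Filling n la mu → Bool
  isValid P = isSSVT-P n la mu
  isValid Q = isSSVT-Q n la mu

  _∋[_]_ : Filling n la mu → Pos → Letter n → Set
  F ∋[ p ] a = T (lookup (lookup F p) a)

  Primed : Letter n → Set
  Primed a = T (isPrimed n a)

  Adjacent : Pos → Pos → Set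
  Adjacent p q = (row p ≡ row q × col q ≡ suc (col p)) ⊎ (col p ≡ col q × row q ≡ suc (row p))

  Nonempty Ordered ColumnStrict RowStrict DiagonalUnprimed : Filling n la mu → Set
  Nonempty F = ∀ p → ∃ (F ∋[ p ]_)
  Ordered F = ∀ p q → Adjacent p q → ∀ a b → F ∋[ p ] a × F ∋[ q ] b → toℕ a ≤ toℕ b
  ColumnStrict F = ∀ p q → col p ≡ col q × row p ≢ row q → ∀ a → ¬ Primed a → ¬ (F ∋[ p ] a × F ∋[ q ] a)
  RowStrict F = ∀ p q → row p ≡ row q × col p ≢ col q → ∀ a → Primed a → ¬ (F ∋[ p ] a × F ∋[ q ] a)
  DiagonalUnprimed F = ∀ p → row p ≡ col p → ∀ a → ¬ (Primed a × F ∋[ p ] a)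

  record Valid (kind : Kind) (F : Filling n la mu) : Set where
    field
      nonempty      : Nonempty F
      ordered       : Ordered F
      column-strict : ColumnStrict F
      row-strict    : RowStrict F
      diagonal      : kind ≡ P → DiagonalUnprimed F

  private
    Valid⇔× : ∀ {kind F} →
              (Nonempty F × Ordered F × ColumnStrict F × RowStrict F × (kind ≡ P → DiagonalUnprimed F))
              ⇔ Valid kind F
    Valid⇔× = mk⇔ (λ (ne , o , c , r , d) → record
                     { nonempty = ne ; ordered = o ; column-strict = c ; row-strict = r ; diagonal = d })
                   (λ v → let open Valid v in nonempty , ordered , column-strict , row-strict , diagonal)

    ∀-cong : ∀ {I : Set} {A B : I → Set} → (∀ i → A i ⇔ B i) → (∀ i → A i) ⇔ (∀ i → B i)
    ∀-cong A⇔B = mk⇔ (λ f i → to (A⇔B i) (f i)) (λ g i → from (A⇔B i) (g i))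

    T-≡ᵇ : ∀ {m n} → T (m ≡ᵇ n) ⇔ (m ≡ n)
    T-≡ᵇ = mk⇔ (ℕ.≡ᵇ⇒≡ _ _) (ℕ.≡⇒≡ᵇ _ _)

    T-≢ᵇ : ∀ {m n} → T (not (m ≡ᵇ n)) ⇔ (m ≢ n)
    T-≢ᵇ = ⇔-trans T-not (¬-cong-⇔ T-≡ᵇ)

    T-≤ᵇ : ∀ {m n} → T (m ≤ᵇ n) ⇔ (m ≤ n)
    T-≤ᵇ = mk⇔ (ℕ.≤ᵇ⇒≤ _ _) ℕ.≤⇒≤ᵇ

    T-nand : ∀ {a b} → T (not (a ∧ b)) ⇔ (¬ (T a × T b))
    T-nand = ⇔-trans T-not (¬-cong-⇔ T-∧)

    T-≡ᵇ∧≡ᵇ : ∀ {i j k l} → T ((i ≡ᵇ j) ∧ (k ≡ᵇ l)) ⇔ (i ≡ j × k ≡ l)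
    T-≡ᵇ∧≡ᵇ = ⇔-trans T-∧ (T-≡ᵇ ×-⇔ T-≡ᵇ)

    T-≡ᵇ∧≢ᵇ : ∀ {i j k l} → T ((i ≡ᵇ j) ∧ not (k ≡ᵇ l)) ⇔ (i ≡ j × k ≢ l)
    T-≡ᵇ∧≢ᵇ = ⇔-trans T-∧ (T-≡ᵇ ×-⇔ T-≢ᵇ)

  T-nonemptyBoxes : ∀ {F} → T (nonemptyBoxes F) ⇔ Nonempty F
  T-nonemptyBoxes = ⇔-trans T-all-allFin (∀-cong λ p → T-any-allFin)

  T-cond1 : ∀ {F} → T (cond1 F) ⇔ Ordered F
  T-cond1 = ⇔-trans T-all-allFin (∀-cong λ p → ⇔-trans T-all-allFin (∀-cong λ q →
    ⇔-trans T-implies (→-cong-⇔ (⇔-trans T-∨ (T-≡ᵇ∧≡ᵇ ⊎-⇔ T-≡ᵇ∧≡ᵇ)) T-maxLeMin)))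
    where
    T-maxLeMin : ∀ {S S′} → T (maxLeMin S S′) ⇔ (∀ a b → T (S a) × T (S′ b) → toℕ a ≤ toℕ b)
    T-maxLeMin = ⇔-trans T-all-allFin (∀-cong λ a → ⇔-trans T-all-allFin (∀-cong λ b →
      ⇔-trans T-implies (→-cong-⇔ T-∧ T-≤ᵇ)))

  T-cond2 : ∀ {F} → T (cond2 F) ⇔ ColumnStrict F
  T-cond2 = ⇔-trans T-all-allFin (∀-cong λ p → ⇔-trans T-all-allFin (∀-cong λ q →
    ⇔-trans T-implies (→-cong-⇔ T-≡ᵇ∧≢ᵇ (⇔-trans T-all-allFin (∀-cong λ a →
      ⇔-trans T-unless (→-cong-⇔ (⇔-id _) T-nand))))))

  T-cond3 : ∀ {F} → T (cond3 F) ⇔ RowStrict F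
  T-cond3 = ⇔-trans T-all-allFin (∀-cong λ p → ⇔-trans T-all-allFin (∀-cong λ q →
    ⇔-trans T-implies (→-cong-⇔ T-≡ᵇ∧≢ᵇ (⇔-trans T-all-allFin (∀-cong λ a →
      ⇔-trans T-implies (→-cong-⇔ (⇔-id _) T-nand))))))

  T-cond4 : ∀ {F} → T (cond4 F) ⇔ DiagonalUnprimed F
  T-cond4 = ⇔-trans T-all-allFin (∀-cong λ p → ⇔-trans T-implies (→-cong-⇔ T-≡ᵇ
    (⇔-trans T-all-allFin (∀-cong λ a → T-nand))))

  T-isValid : ∀ kind {F} → T (isValid kind F) ⇔ Valid kind F
  T-isValid P {F} = ⇔-trans (⇔-trans T-∧ (T-nonemptyBoxes {F} ×-⇔ ⇔-trans T-∧ (T-cond1 {F} ×-⇔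
    ⇔-trans T-∧ (T-cond2 {F} ×-⇔ ⇔-trans T-∧ (T-cond3 {F} ×-⇔
      mk⇔ (λ d _ → to (T-cond4 {F}) d) (λ d → from (T-cond4 {F}) (d refl))))))) Valid⇔×
  T-isValid Q {F} = ⇔-trans (⇔-trans T-∧ (T-nonemptyBoxes {F} ×-⇔ ⇔-trans T-∧ (T-cond1 {F} ×-⇔
    ⇔-trans T-∧ (T-cond2 {F} ×-⇔
      mk⇔ (λ r → to (T-cond3 {F}) r , λ ()) (λ r → from (T-cond3 {F}) (proj₁ r)))))) Valid⇔×

  valid⇒isValid : ∀ {kind F} → Valid kind F → isValid kind F ≡ true
  valid⇒isValid {kind} {F} = to T-≡ ∘ from (T-isValid kind {F})

  isValid⇒valid : ∀ {kind F} → isValid kind F ≡ true → Valid kind F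
  isValid⇒valid {kind} {F} = to (T-isValid kind {F}) ∘ from T-≡

  _≟ᶠ_ : DecidableEquality (Filling n la mu)
  _≟ᶠ_ = ≡-dec (≡-dec Bool._≟_)

  allFillings-isEnumeration : IsEnumeration _≟ᶠ_ (Tab.allFillings n la mu)
  allFillings-isEnumeration =
    allVecs-isEnumeration (allVecs-isEnumeration bools-isEnumeration (2 * n)) (length (boxes la mu))
    where
    bools-isEnumeration : IsEnumeration Bool._≟_ (true ∷ false ∷ [])
    bools-isEnumeration true  = refl
    bools-isEnumeration false = refl

  allFillings-complete : ∀ F → F ∈ Tab.allFillings n la mu
  allFillings-complete = enumeration-∈ {_≟_ = _≟ᶠ_} allFillings-isEnumeration

  _⊆ᶠ_ : Filling n la mu → Filling n la mu → Set
  F′ ⊆ᶠ F = ∀ p a → F′ ∋[ p ] a → F ∋[ p ] a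

  valid-⊆ : ∀ {kind} F {F′} → Valid kind F → Nonempty F′ → F′ ⊆ᶠ F → Valid kind F′
  valid-⊆ F valid nonempty′ F′⊆F = record
    { nonempty      = nonempty′
    ; ordered       = λ p q adj a b (a∈ , b∈) → ordered p q adj a b (F′⊆F p a a∈ , F′⊆F q b b∈)
    ; column-strict = λ p q pq a ¬pr (a∈p , a∈q) → column-strict p q pq a ¬pr (F′⊆F p a a∈p , F′⊆F q a a∈q)
    ; row-strict    = λ p q pq a pr (a∈p , a∈q) → row-strict p q pq a pr (F′⊆F p a a∈p , F′⊆F q a a∈q)
    ; diagonal      = λ k≡P p d a (pr , a∈) → diagonal k≡P p d a (pr , F′⊆F p a a∈)
    }
    where open Valid valid

  module _ (F : Filling n la mu) (nonempty : Nonempty F) (ordered : Ordered F) where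
    private
      chain : (π σ : Pos → ℕ) →
              (∀ p q → π p ≡ π q → σ p < σ q → ∃ λ r → π r ≡ π p × σ r ≡ suc (σ p)) →
              (∀ p r → π p ≡ π r → σ r ≡ suc (σ p) → Adjacent p r) →
              ∀ d p q → π p ≡ π q → σ q ≡ suc (σ p) + d →
              ∀ a b → F ∋[ p ] a × F ∋[ q ] b → toℕ a ≤ toℕ b
      chain π σ next adjacent zero p q πp≡πq σq≡ a b ab =
        ordered p q (adjacent p q πp≡πq (trans σq≡ (ℕ.+-identityʳ _))) a b ab
      chain π σ next adjacent (suc d) p q πp≡πq σq≡ a b (a∈ , b∈)
        with next p q πp≡πq (ℕ.≤-trans (ℕ.m≤m+n (suc (σ p)) (suc d)) (ℕ.≤-reflexive (sym σq≡)))
      ... | r , πr≡πp , σr≡ with nonempty r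
      ... | c , c∈ = ℕ.≤-trans (ordered p r (adjacent p r (sym πr≡πp) σr≡) a c (a∈ , c∈))
                       (chain π σ next adjacent d r q (trans πr≡πp πp≡πq)
                         (trans σq≡ (trans (ℕ.+-suc (suc (σ p)) d) (cong (λ s → suc s + d) (sym σr≡))))
                         c b (c∈ , b∈))

    ordered-row : ∀ p q → row p ≡ row q → col p < col q →
                  ∀ a b → F ∋[ p ] a × F ∋[ q ] b → toℕ a ≤ toℕ b
    ordered-row p q rp≡rq cp<cq = chain row col right-neighbour (λ p r e e′ → inj₁ (e , e′))
      (col q ∸ suc (col p)) p q rp≡rq (sym (ℕ.m+[n∸m]≡n cp<cq))

    ordered-col : ∀ p q → col p ≡ col q → row p < row q →
                  ∀ a b → F ∋[ p ] a × F ∋[ q ] b → toℕ a ≤ toℕ b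
    ordered-col p q cp≡cq rp<rq = chain col row lower-neighbour (λ p r e e′ → inj₂ (e , e′))
      (row q ∸ suc (row p)) p q cp≡cq (sym (ℕ.m+[n∸m]≡n rp<rq))

module Candidates (n : ℕ) {la mu : List ℕ} (sp-la : IsStrictPartition la) (sp-mu : IsStrictPartition mu)
                  (la⊇mu : la ⊇ mu) (kind : Kind) where
  open Fillings n sp-la sp-mu la⊇mu
  open SubsetVectors
  open BooleanReflection using (T-not)

  Mins : Set
  Mins = Vec ℕ (length (boxes la mu))

  mins : Filling n la mu → Mins
  mins = Vec.map least

  -- The letter a may be added to or removed from box b of any valid filling whose box minima
  -- are M (toggleAt-valid); the conditions mention M only.
  record Candidate (M : Mins) (b : Pos) (a : Letter n) : Set where
    field
      least<       : lookup M b < toℕ a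
      ≤right       : ∀ q → row q ≡ row b → col b < col q → toℕ a ≤ lookup M q
      ≤below       : ∀ q → col q ≡ col b → row b < row q → toℕ a ≤ lookup M q
      primed-row   : Primed a → ∀ q → row q ≡ row b → col q ≢ col b → toℕ a ≢ lookup M q
      unprimed-col : ¬ Primed a → ∀ q → col q ≡ col b → row q ≢ row b → toℕ a ≢ lookup M q
      unprimed-if-diagonal : kind ≡ P → row b ≡ col b → ¬ Primed a

  candidate? : ∀ M b a → Dec (Candidate M b a)
  candidate? M b a = map′
    (λ (l , r , d , pr , un , dg) → record
      { least< = l ; ≤right = r ; ≤below = d ; primed-row = pr ; unprimed-col = un ; unprimed-if-diagonal = dg })
    (λ c → let open Candidate c in least< , ≤right , ≤below , primed-row , unprimed-col , unprimed-if-diagonal)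
    (  lookup M b ℕ.<? toℕ a
    ×-dec Fin.all? (λ q → (row q ℕ.≟ row b) →-dec (col b ℕ.<? col q) →-dec (toℕ a ℕ.≤? lookup M q))
    ×-dec Fin.all? (λ q → (col q ℕ.≟ col b) →-dec (row b ℕ.<? row q) →-dec (toℕ a ℕ.≤? lookup M q))
    ×-dec (T? (isPrimed n a) →-dec Fin.all? (λ q → (row q ℕ.≟ row b) →-dec ¬? (col q ℕ.≟ col b)
                                                    →-dec ¬? (toℕ a ℕ.≟ lookup M q)))
    ×-dec (¬? (T? (isPrimed n a)) →-dec Fin.all? (λ q → (col q ℕ.≟ col b) →-dec ¬? (row q ℕ.≟ row b)
                                                    →-dec ¬? (toℕ a ℕ.≟ lookup M q)))
    ×-dec (isP? kind →-dec (row b ℕ.≟ col b) →-dec ¬? (T? (isPrimed n a))))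
    where
    isP? : ∀ k → Dec (k ≡ P)
    isP? P = yes refl
    isP? Q = no (λ ())

  toggleAt : Filling n la mu → Pos → Letter n → Filling n la mu
  toggleAt F b a = updateAt F b (λ S → toggle S a)

  toggleAt-involutive : ∀ F b a → toggleAt (toggleAt F b a) b a ≡ F
  toggleAt-involutive F b a =
    trans (updateAt-updateAt b F) (updateAt-id-local b F (toggle-involutive (lookup F b) a))

  toggleAt-∋⁻ : ∀ F b a p x → toggleAt F b a ∋[ p ] x → F ∋[ p ] x ⊎ (p ≡ b × x ≡ a)
  toggleAt-∋⁻ F b a p x x∈ with p Fin.≟ b
  ... | no p≢b = inj₁ (subst T (cong (λ S → lookup S x) (lookup∘updateAt′ p b p≢b F)) x∈)
  ... | yes refl with x Fin.≟ a
  ...   | yes refl = inj₂ (refl , refl)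
  ...   | no x≢a   = inj₁ (subst T (trans (cong (λ S → lookup S x) (lookup∘updateAt b F))
                                          (lookup∘updateAt′ x a x≢a (lookup F b))) x∈)

  toggleAt-∋⁺ : ∀ F b a p x → F ∋[ p ] x → (p ≡ b → x ≢ a) → toggleAt F b a ∋[ p ] x
  toggleAt-∋⁺ F b a p x x∈ fresh with p Fin.≟ b
  ... | no p≢b   = subst T (cong (λ S → lookup S x) (sym (lookup∘updateAt′ p b p≢b F))) x∈
  ... | yes refl = subst T (sym (trans (cong (λ S → lookup S x) (lookup∘updateAt b F))
                                       (lookup∘updateAt′ x a (fresh refl) (lookup F b)))) x∈

  toggleAt-self : ∀ F b a → lookup (lookup (toggleAt F b a) b) a ≡ not (lookup (lookup F b) a)
  toggleAt-self F b a = trans (cong (λ S → lookup S a) (lookup∘updateAt b F)) (lookup∘updateAt a (lookup F b))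

  toggleAt-∋-new : ∀ F b a → ¬ F ∋[ b ] a → toggleAt F b a ∋[ b ] a
  toggleAt-∋-new F b a a∉ = subst T (sym (toggleAt-self F b a)) (from T-not a∉)

  lookup-mins : ∀ F q → lookup (mins F) q ≡ least (lookup F q)
  lookup-mins F q = lookup-map q least F

  mins-≤ : ∀ F q x → F ∋[ q ] x → lookup (mins F) q ≤ toℕ x
  mins-≤ F q x x∈ = subst (_≤ toℕ x) (sym (lookup-mins F q)) (least-≤ (lookup F q) x x∈)

  mins-attained : ∀ F → Nonempty F → ∀ q → ∃ λ y → F ∋[ q ] y × toℕ y ≡ lookup (mins F) q
  mins-attained F nonempty q with least-∈ (lookup F q) _ (proj₂ (nonempty q))
  ... | y , y∈ , y≡ = y , y∈ , trans y≡ (sym (lookup-mins F q))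

  mins-toggleAt : ∀ F b a → lookup (mins F) b < toℕ a → mins (toggleAt F b a) ≡ mins F
  mins-toggleAt F b a lt =
    trans (map-updateAt F b (least-toggle (lookup F b) a (subst (_< toℕ a) (lookup-mins F b) lt)))
          (updateAt-id b (mins F))

  ∋-mins : ∀ F → Nonempty F → ∀ q x → toℕ x ≡ lookup (mins F) q → F ∋[ q ] x
  ∋-mins F nonempty q x x≡ with mins-attained F nonempty q
  ... | y , y∈ , y≡ = subst (F ∋[ q ]_) (Fin.toℕ-injective (trans y≡ (sym x≡))) y∈

  adjacent-irreflexive : ∀ p → ¬ Adjacent p p
  adjacent-irreflexive p (inj₁ (_ , c≡1+c)) = ℕ.1+n≢n (sym c≡1+c)
  adjacent-irreflexive p (inj₂ (_ , r≡1+r)) = ℕ.1+n≢n (sym r≡1+r)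

  module _ {F b a} (valid : Valid kind F) (c : Candidate (mins F) b a) where
    open Valid valid
    open Candidate c

    private
      yb = proj₁ (mins-attained F nonempty b)
      yb∈ = proj₁ (proj₂ (mins-attained F nonempty b))

      yb<a : toℕ yb < toℕ a
      yb<a = subst (_< toℕ a) (sym (proj₂ (proj₂ (mins-attained F nonempty b)))) least<

      a≤neighbour : ∀ q → Adjacent b q → toℕ a ≤ lookup (mins F) q
      a≤neighbour q (inj₁ (rb≡rq , cq≡)) = ≤right q (sym rb≡rq) (ℕ.≤-reflexive (sym cq≡))
      a≤neighbour q (inj₂ (cb≡cq , rq≡)) = ≤below q (sym cb≡cq) (ℕ.≤-reflexive (sym rq≡))

      column-clash : ∀ q → col q ≡ col b → row q ≢ row b → ¬ Primed a → ¬ F ∋[ q ] a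
      column-clash q cq≡cb rq≢rb ¬pr a∈ with ℕ.<-cmp (row b) (row q)
      ... | tri< rb<rq _ _ = unprimed-col ¬pr q cq≡cb rq≢rb (ℕ.≤-antisym (≤below q cq≡cb rb<rq) (mins-≤ F q a a∈))
      ... | tri≈ _ rb≡rq _ = rq≢rb (sym rb≡rq)
      ... | tri> _ _ rq<rb = ℕ.<-irrefl refl
                               (ℕ.≤-<-trans (ordered-col F nonempty ordered q b cq≡cb rq<rb a yb (a∈ , yb∈)) yb<a)

      row-clash : ∀ q → row q ≡ row b → col q ≢ col b → Primed a → ¬ F ∋[ q ] a
      row-clash q rq≡rb cq≢cb pr a∈ with ℕ.<-cmp (col b) (col q)
      ... | tri< cb<cq _ _ = primed-row pr q rq≡rb cq≢cb (ℕ.≤-antisym (≤right q rq≡rb cb<cq) (mins-≤ F q a a∈))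
      ... | tri≈ _ cb≡cq _ = cq≢cb (sym cb≡cq)
      ... | tri> _ _ cq<cb = ℕ.<-irrefl refl
                               (ℕ.≤-<-trans (ordered-row F nonempty ordered q b rq≡rb cq<cb a yb (a∈ , yb∈)) yb<a)

    toggleAt-nonempty : Nonempty (toggleAt F b a)
    toggleAt-nonempty p with mins-attained F nonempty p
    ... | y , y∈ , y≡ =
      y , toggleAt-∋⁺ F b a p y y∈ λ { refl y≡a → ℕ.<-irrefl (trans (sym y≡) (cong toℕ y≡a)) least< }

    toggleAt-ordered : Ordered (toggleAt F b a)
    toggleAt-ordered p q adj x y (x∈ , y∈) with toggleAt-∋⁻ F b a p x x∈ | toggleAt-∋⁻ F b a q y y∈
    ... | inj₁ x∈F           | inj₁ y∈F           = ordered p q adj x y (x∈F , y∈F)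
    ... | inj₂ (refl , refl) | inj₂ (refl , refl) = ⊥-elim (adjacent-irreflexive p adj)
    ... | inj₂ (refl , refl) | inj₁ y∈F           = ℕ.≤-trans (a≤neighbour q adj) (mins-≤ F q y y∈F)
    ... | inj₁ x∈F           | inj₂ (refl , refl) = ℕ.<⇒≤ (ℕ.≤-<-trans (ordered p b adj x yb (x∈F , yb∈)) yb<a)

    toggleAt-columnStrict : ColumnStrict (toggleAt F b a)
    toggleAt-columnStrict p q (cp≡cq , rp≢rq) x ¬pr (x∈p , x∈q)
      with toggleAt-∋⁻ F b a p x x∈p | toggleAt-∋⁻ F b a q x x∈q
    ... | inj₁ x∈Fp          | inj₁ x∈Fq          = column-strict p q (cp≡cq , rp≢rq) x ¬pr (x∈Fp , x∈Fq)
    ... | inj₂ (refl , refl) | inj₂ (refl , _)    = rp≢rq refl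
    ... | inj₂ (refl , refl) | inj₁ x∈Fq          = column-clash q (sym cp≡cq) (rp≢rq ∘ sym) ¬pr x∈Fq
    ... | inj₁ x∈Fp          | inj₂ (refl , refl) = column-clash p cp≡cq rp≢rq ¬pr x∈Fp

    toggleAt-rowStrict : RowStrict (toggleAt F b a)
    toggleAt-rowStrict p q (rp≡rq , cp≢cq) x pr (x∈p , x∈q)
      with toggleAt-∋⁻ F b a p x x∈p | toggleAt-∋⁻ F b a q x x∈q
    ... | inj₁ x∈Fp          | inj₁ x∈Fq          = row-strict p q (rp≡rq , cp≢cq) x pr (x∈Fp , x∈Fq)
    ... | inj₂ (refl , refl) | inj₂ (refl , _)    = cp≢cq refl
    ... | inj₂ (refl , refl) | inj₁ x∈Fq          = row-clash q (sym rp≡rq) (cp≢cq ∘ sym) pr x∈Fq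
    ... | inj₁ x∈Fp          | inj₂ (refl , refl) = row-clash p rp≡rq cp≢cq pr x∈Fp

    toggleAt-diagonal : kind ≡ P → DiagonalUnprimed (toggleAt F b a)
    toggleAt-diagonal k≡P p rp≡cp x (pr , x∈) with toggleAt-∋⁻ F b a p x x∈
    ... | inj₁ x∈F           = diagonal k≡P p rp≡cp x (pr , x∈F)
    ... | inj₂ (refl , refl) = unprimed-if-diagonal k≡P rp≡cp pr

    toggleAt-valid : Valid kind (toggleAt F b a)
    toggleAt-valid = record
      { nonempty      = toggleAt-nonempty
      ; ordered       = toggleAt-ordered
      ; column-strict = toggleAt-columnStrict
      ; row-strict    = toggleAt-rowStrict
      ; diagonal      = toggleAt-diagonal
      }

  extra-isCandidate : ∀ {F} → Valid kind F → ∀ p x → F ∋[ p ] x → lookup (mins F) p < toℕ x →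
                      Candidate (mins F) p x
  extra-isCandidate {F} valid p x x∈ lt = record
    { least<       = lt
    ; ≤right       = λ q rq≡rp cp<cq → x≤mins q (ordered-row F nonempty ordered p q (sym rq≡rp) cp<cq)
    ; ≤below       = λ q cq≡cp rp<rq → x≤mins q (ordered-col F nonempty ordered p q (sym cq≡cp) rp<rq)
    ; primed-row   = λ pr q rq≡rp cq≢cp x≡ →
        row-strict p q (sym rq≡rp , cq≢cp ∘ sym) x pr (x∈ , ∋-mins F nonempty q x x≡)
    ; unprimed-col = λ ¬pr q cq≡cp rq≢rp x≡ →
        column-strict p q (sym cq≡cp , rq≢rp ∘ sym) x ¬pr (x∈ , ∋-mins F nonempty q x x≡)
    ; unprimed-if-diagonal = λ k≡P rp≡cp pr → diagonal k≡P p rp≡cp x (pr , x∈)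
    }
    where
    open Valid valid
    x≤mins : ∀ q → (∀ a b → F ∋[ p ] a × F ∋[ q ] b → toℕ a ≤ toℕ b) → toℕ x ≤ lookup (mins F) q
    x≤mins q ordered-pq with mins-attained F nonempty q
    ... | y , y∈ , y≡ = subst (toℕ x ≤_) y≡ (ordered-pq x y (x∈ , y∈))

module FixedPoints (n : ℕ) {la mu : List ℕ} (sp-la : IsStrictPartition la) (sp-mu : IsStrictPartition mu)
                   (la⊇mu : la ⊇ mu) (kind : Kind) where
  open Fillings n sp-la sp-mu la⊇mu
  open Candidates n sp-la sp-mu la⊇mu kind
  open SubsetVectors

  record Fixed (F : Filling n la mu) : Set where
    field
      valid        : Valid kind F
      no-candidate : ∀ b a → ¬ Candidate (mins F) b a

  fixed-∋ : ∀ {F} → Fixed F → ∀ p x → F ∋[ p ] x → toℕ x ≡ lookup (mins F) p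
  fixed-∋ {F} fixed p x x∈ with ℕ.m≤n⇒m<n∨m≡n (mins-≤ F p x x∈)
  ... | inj₁ lt = ⊥-elim (Fixed.no-candidate fixed p x (extra-isCandidate (Fixed.valid fixed) p x x∈ lt))
  ... | inj₂ eq = sym eq

  fixed-keepLeast : ∀ {F} → Fixed F → ∀ p → keepLeast (lookup F p) ≡ lookup F p
  fixed-keepLeast {F} fixed p =
    keepLeast-id (lookup F p) (λ x x∈ → trans (fixed-∋ fixed p x x∈) (lookup-mins F p))

  -- If the minima of two fixed points agree at every box of smaller rank but differ at b, then
  -- the least entry at b of the larger one is a candidate for the other.
  private
    module SmallerMinimum {F₁ F₂} (fixed₁ : Fixed F₁) (fixed₂ : Fixed F₂) (b : Pos)
                          (agree : ∀ q → rank q < rank b → lookup (mins F₁) q ≡ lookup (mins F₂) q)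
                          (lt : lookup (mins F₁) b < lookup (mins F₂) b) where
      open Valid (Fixed.valid fixed₁) using () renaming (nonempty to ne₁; ordered to ord₁)
      open Valid (Fixed.valid fixed₂) using (row-strict; column-strict; diagonal)
        renaming (nonempty to ne₂; ordered to ord₂)

      M₁ = lookup (mins F₁)
      M₂ = lookup (mins F₂)
      a = proj₁ (mins-attained F₂ ne₂ b)
      a∈ = proj₁ (proj₂ (mins-attained F₂ ne₂ b))
      a≡ = proj₂ (proj₂ (mins-attained F₂ ne₂ b))

      a≤M₂ : ∀ q → (∀ x y → F₂ ∋[ b ] x × F₂ ∋[ q ] y → toℕ x ≤ toℕ y) → toℕ a ≤ M₂ q
      a≤M₂ q ordered-bq with mins-attained F₂ ne₂ q
      ... | y , y∈ , y≡ = subst (toℕ a ≤_) y≡ (ordered-bq a y (a∈ , y∈))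

      M₁≢a : ∀ q → (∀ x y → F₁ ∋[ q ] x × F₁ ∋[ b ] y → toℕ x ≤ toℕ y) → toℕ a ≢ M₁ q
      M₁≢a q ordered-qb a≡M₁q with mins-attained F₁ ne₁ q | mins-attained F₁ ne₁ b
      ... | y , y∈ , y≡ | z , z∈ , z≡ = ℕ.<-irrefl refl (begin-strict
        toℕ a   ≡⟨ trans a≡M₁q (sym y≡) ⟩
        toℕ y   ≤⟨ ordered-qb y z (y∈ , z∈) ⟩
        toℕ z   ≡⟨ z≡ ⟩
        M₁ b    <⟨ lt ⟩
        M₂ b    ≡⟨ a≡ ⟨
        toℕ a   ∎)
        where open ℕ.≤-Reasoning

      primed-row′ : Primed a → ∀ q → row q ≡ row b → col q ≢ col b → toℕ a ≢ M₁ q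
      primed-row′ pr q rq≡rb cq≢cb a≡M₁q with ℕ.<-cmp (col b) (col q)
      ... | tri< cb<cq _ _ = row-strict b q (sym rq≡rb , cq≢cb ∘ sym) a pr
                               (a∈ , ∋-mins F₂ ne₂ q a (trans a≡M₁q (agree q (rank-right b q rq≡rb cb<cq))))
      ... | tri≈ _ cb≡cq _ = cq≢cb (sym cb≡cq)
      ... | tri> _ _ cq<cb = M₁≢a q (ordered-row F₁ ne₁ ord₁ q b rq≡rb cq<cb) a≡M₁q

      unprimed-col′ : ¬ Primed a → ∀ q → col q ≡ col b → row q ≢ row b → toℕ a ≢ M₁ q
      unprimed-col′ ¬pr q cq≡cb rq≢rb a≡M₁q with ℕ.<-cmp (row b) (row q)
      ... | tri< rb<rq _ _ = column-strict b q (sym cq≡cb , rq≢rb ∘ sym) a ¬pr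
                               (a∈ , ∋-mins F₂ ne₂ q a (trans a≡M₁q (agree q (rank-down b q rb<rq))))
      ... | tri≈ _ rb≡rq _ = rq≢rb (sym rb≡rq)
      ... | tri> _ _ rq<rb = M₁≢a q (ordered-col F₁ ne₁ ord₁ q b cq≡cb rq<rb) a≡M₁q

      candidate : Candidate (mins F₁) b a
      candidate = record
        { least<       = subst (M₁ b <_) (sym a≡) lt
        ; ≤right       = λ q rq≡rb cb<cq → subst (toℕ a ≤_) (sym (agree q (rank-right b q rq≡rb cb<cq)))
                                             (a≤M₂ q (ordered-row F₂ ne₂ ord₂ b q (sym rq≡rb) cb<cq))
        ; ≤below       = λ q cq≡cb rb<rq → subst (toℕ a ≤_) (sym (agree q (rank-down b q rb<rq)))
                                             (a≤M₂ q (ordered-col F₂ ne₂ ord₂ b q (sym cq≡cb) rb<rq))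
        ; primed-row   = primed-row′
        ; unprimed-col = unprimed-col′
        ; unprimed-if-diagonal = λ k≡P rb≡cb pr → diagonal k≡P b rb≡cb a (pr , a∈)
        }

      contradiction : ⊥
      contradiction = Fixed.no-candidate fixed₁ b a candidate

  fixed-unique : ∀ {F₁ F₂} → Fixed F₁ → Fixed F₂ → F₁ ≡ F₂
  fixed-unique {F₁} {F₂} fixed₁ fixed₂ =
    trans (sym (tabulate∘lookup F₁)) (trans (Vecₚ.tabulate-cong same-box) (tabulate∘lookup F₂))
    where
    mins-agree : ∀ b → Acc _<_ (rank b) → lookup (mins F₁) b ≡ lookup (mins F₂) b
    mins-agree b (acc smaller) with ℕ.<-cmp (lookup (mins F₁) b) (lookup (mins F₂) b)
    ... | tri≈ _ eq _ = eq
    ... | tri< lt _ _ =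
      ⊥-elim (SmallerMinimum.contradiction fixed₁ fixed₂ b (λ q r → mins-agree q (smaller r)) lt)
    ... | tri> _ _ gt =
      ⊥-elim (SmallerMinimum.contradiction fixed₂ fixed₁ b (λ q r → sym (mins-agree q (smaller r))) gt)

    same-box : ∀ p → lookup F₁ p ≡ lookup F₂ p
    same-box p = begin
      lookup F₁ p              ≡⟨ fixed-keepLeast fixed₁ p ⟨
      keepLeast (lookup F₁ p)  ≡⟨ keepLeast-cong (lookup F₁ p) (lookup F₂ p)
                                    (proj₂ (Valid.nonempty (Fixed.valid fixed₁) p))
                                    (proj₂ (Valid.nonempty (Fixed.valid fixed₂) p))
                                    (trans (sym (lookup-mins F₁ p))
                                      (trans (mins-agree p (<-wellFounded (rank p))) (lookup-mins F₂ p))) ⟩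
      keepLeast (lookup F₂ p)  ≡⟨ fixed-keepLeast fixed₂ p ⟩
      lookup F₂ p              ∎
      where open ≡-Reasoning

  -- each box has at most one entry
  SingleValued : Filling n la mu → Set
  SingleValued F = Vec.map keepLeast F ≡ F

  singleValued-∋ : ∀ {F} → SingleValued F → ∀ p x → F ∋[ p ] x → toℕ x ≡ lookup (mins F) p
  singleValued-∋ {F} single p x x∈ =
    trans (keepLeast-least (lookup F p) x (subst (λ S → T (lookup S x)) box≡ x∈)) (sym (lookup-mins F p))
    where
    box≡ : lookup F p ≡ keepLeast (lookup F p)
    box≡ = trans (cong (λ G → lookup G p) (sym single)) (lookup-map p keepLeast F)

  Φ : Filling n la mu → ℕ
  Φ F = Vec.sum (mins F)

  raise : Filling n la mu → Pos → Letter n → Filling n la mu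
  raise F b a = updateAt F b (λ _ → ⁅ a ⁆)

  raise-∋⁻ : ∀ F b a p x → raise F b a ∋[ p ] x → (p ≡ b × x ≡ a) ⊎ (p ≢ b × F ∋[ p ] x)
  raise-∋⁻ F b a p x x∈ with p Fin.≟ b
  ... | yes refl = inj₁ (refl , ∈⁅⁆ a x (subst (λ S → T (lookup S x)) (lookup∘updateAt b F) x∈))
  ... | no p≢b   = inj₂ (p≢b , subst (λ S → T (lookup S x)) (lookup∘updateAt′ p b p≢b F) x∈)

  private
    sum-updateAt-< : ∀ {m} (v : Vec ℕ m) i {c} → lookup v i < c → Vec.sum v < Vec.sum (updateAt v i (λ _ → c))
    sum-updateAt-< (x ∷ v) zero    lt = ℕ.+-monoˡ-< (Vec.sum v) lt
    sum-updateAt-< (x ∷ v) (suc i) lt = ℕ.+-monoʳ-< x (sum-updateAt-< v i lt)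

  module _ {F b a} (valid : Valid kind F) (single : SingleValued F) (c : Candidate (mins F) b a) where

    raise-valid : Valid kind (raise F b a)
    raise-valid = valid-⊆ (toggleAt F b a) (toggleAt-valid valid c) nonempty raise⊆toggleAt
      where
      nonempty : Nonempty (raise F b a)
      nonempty p with p Fin.≟ b | Valid.nonempty valid p
      ... | yes refl | _      = a , subst (λ S → T (lookup S a)) (sym (lookup∘updateAt b F)) (⁅⁆-∋ a)
      ... | no p≢b   | x , x∈ = x , subst (λ S → T (lookup S x)) (sym (lookup∘updateAt′ p b p≢b F)) x∈

      raise⊆toggleAt : raise F b a ⊆ᶠ toggleAt F b a
      raise⊆toggleAt p x x∈ with raise-∋⁻ F b a p x x∈
      ... | inj₁ (refl , refl) = toggleAt-∋-new F b a
          (λ a∈ → ℕ.<-irrefl (sym (singleValued-∋ single b a a∈)) (Candidate.least< c))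
      ... | inj₂ (p≢b , x∈F)   = toggleAt-∋⁺ F b a p x x∈F (λ p≡b → ⊥-elim (p≢b p≡b))

    raise-singleValued : SingleValued (raise F b a)
    raise-singleValued = trans (map-updateAt F b (keepLeast-⁅⁆ a)) (cong (λ G → updateAt G b (λ _ → ⁅ a ⁆)) single)

    Φ-raise : Φ F < Φ (raise F b a)
    Φ-raise = subst (λ M → Vec.sum (mins F) < Vec.sum M) (sym (map-updateAt F b (least-⁅⁆ a)))
                    (sum-updateAt-< (mins F) b (Candidate.least< c))

  ValidSingleValued : Filling n la mu → Set
  ValidSingleValued F = T (isValid kind F) × SingleValued F

  validSingleValued? : ∀ F → Dec (ValidSingleValued F)
  validSingleValued? F = T? (isValid kind F) ×-dec (Vec.map keepLeast F ≟ᶠ F)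

  -- Raising a candidate keeps validity and increases Φ, so a maximiser of Φ among the valid
  -- single-valued fillings has no candidate.
  module Maximiser (F₀ : Filling n la mu) (valid₀ : Valid kind F₀) where

    start : Filling n la mu
    start = Vec.map keepLeast F₀

    start-validSingleValued : ValidSingleValued start
    start-validSingleValued =
        from (T-isValid kind {start}) (valid-⊆ F₀ valid₀ nonempty start⊆F₀)
      , trans (sym (Vecₚ.map-∘ keepLeast keepLeast F₀)) (Vecₚ.map-cong keepLeast-idempotent F₀)
      where
      nonempty : Nonempty start
      nonempty p with Valid.nonempty valid₀ p
      ... | x , x∈ with keepLeast-nonempty (lookup F₀ p) x x∈
      ...   | y , y∈ = y , subst (λ S → T (lookup S y)) (sym (lookup-map p keepLeast F₀)) y∈

      start⊆F₀ : start ⊆ᶠ F₀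
      start⊆F₀ p x x∈ = keepLeast-⊆ (lookup F₀ p) x (subst (λ S → T (lookup S x)) (lookup-map p keepLeast F₀) x∈)

    candidates = filter validSingleValued? (Tab.allFillings n la mu)

    best : Filling n la mu
    best = argmax Φ start candidates

    best-validSingleValued : ValidSingleValued best
    best-validSingleValued = argmax-all Φ {xs = candidates} start-validSingleValued
                               (Allₚ.all-filter validSingleValued? (Tab.allFillings n la mu))

    best-maximal : ∀ G → ValidSingleValued G → Φ G ≤ Φ best
    best-maximal G good = All.lookup (f[xs]≤f[argmax] start candidates)
                                     (∈-filter⁺ validSingleValued? (allFillings-complete G) good)

    best-fixed : Fixed best
    best-fixed = record { valid = valid ; no-candidate = no-candidate }
      where
      valid = to (T-isValid kind {best}) (proj₁ best-validSingleValued)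
      single = proj₂ best-validSingleValued
      no-candidate : ∀ b a → ¬ Candidate (mins best) b a
      no-candidate b a c = ℕ.<-irrefl refl (ℕ.<-≤-trans (Φ-raise valid single c)
        (best-maximal (raise best b a)
          (from (T-isValid kind) (raise-valid valid single c) , raise-singleValued valid single c)))

  fixed-exists : ∀ F₀ → Valid kind F₀ → ∃ Fixed
  fixed-exists F₀ valid₀ = Maximiser.best F₀ valid₀ , Maximiser.best-fixed F₀ valid₀

module Coefficients where
  open import Data.Integer using (_+_)
  open FiniteSums

  monomialCoeff : ℤ × ℤ → ℤ → ℤ
  monomialCoeff (c , d) e = if does (d ℤ.≟ e) then c else + 0

  coeff-map-filter : ∀ {A : Set} (xs : List A) (keep : A → Bool) (g : A → ℤ × ℤ) e →
                     coeff (map g (filter (T? ∘ keep) xs)) e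
                     ≡ ∑[ x ∈ xs ] (if keep x then monomialCoeff (g x) e else + 0)
  coeff-map-filter []       keep g e = refl
  coeff-map-filter (x ∷ xs) keep g e with keep x
  ... | true  = cong (_+_ (monomialCoeff (g x) e)) (coeff-map-filter xs keep g e)
  ... | false = trans (coeff-map-filter xs keep g e) (sym (ℤ.+-identityˡ _))

module Involution (n : ℕ) {la mu : List ℕ} (sp-la : IsStrictPartition la) (sp-mu : IsStrictPartition mu)
                  (la⊇mu : la ⊇ mu) (kind : Kind) where
  open Fillings n sp-la sp-mu la⊇mu
  open Candidates n sp-la sp-mu la⊇mu kind
  open FixedPoints n sp-la sp-mu la⊇mu kind

  CandidateChoice : Mins → Set
  CandidateChoice M = Dec (∃ λ b → ∃ (Candidate M b))

  candidates? : ∀ M → CandidateChoice M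
  candidates? M = Fin.any? (λ b → Fin.any? (candidate? M b))

  choiceOf : ∀ {M} → CandidateChoice M → Maybe (Pos × Letter n)
  choiceOf (yes (b , a , _)) = just (b , a)
  choiceOf (no _)            = nothing

  choice : Mins → Maybe (Pos × Letter n)
  choice M = choiceOf (candidates? M)

  choice-just : ∀ {M b a} (d : CandidateChoice M) → choiceOf d ≡ just (b , a) → Candidate M b a
  choice-just (yes (b , a , c)) refl = c

  choice-nothing : ∀ {M} (d : CandidateChoice M) → choiceOf d ≡ nothing → ∀ b a → ¬ Candidate M b a
  choice-nothing (no none) _ b a c = none (b , a , c)

  toggleChosen : Filling n la mu → Maybe (Pos × Letter n) → Filling n la mu
  toggleChosen F (just (b , a)) = toggleAt F b a
  toggleChosen F nothing        = F

  -- Toggling a candidate leaves the minima unchanged (mins-toggleAt), so ι F and F make the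
  -- same choice: this is why ι is an involution.
  ι : Filling n la mu → Filling n la mu
  ι F = if isValid kind F then toggleChosen F (choice (mins F)) else F

  ι-invalid : ∀ {F} → isValid kind F ≡ false → ι F ≡ F
  ι-invalid {F} invalid = cong (λ v → if v then toggleChosen F (choice (mins F)) else F) invalid

  ι-valid : ∀ {F} → isValid kind F ≡ true → ι F ≡ toggleChosen F (choice (mins F))
  ι-valid {F} valid = cong (λ v → if v then toggleChosen F (choice (mins F)) else F) valid

  data ιCase (F : Filling n la mu) : Set where
    on-invalid   : isValid kind F ≡ false → ιCase F
    on-fixed     : Fixed F → ι F ≡ F → ιCase F
    on-candidate : ∀ b a → Valid kind F → Candidate (mins F) b a →
                   ι F ≡ toggleAt F b a → ι (toggleAt F b a) ≡ F → ιCase F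

  ι-case : ∀ F → ιCase F
  ι-case F = by-validity (isValid kind F) refl
    where
    by-choice : isValid kind F ≡ true → ∀ m → choice (mins F) ≡ m → ιCase F
    by-choice valid nothing none =
      on-fixed (record { valid = isValid⇒valid valid ; no-candidate = choice-nothing (candidates? (mins F)) none })
               (trans (ι-valid valid) (cong (toggleChosen F) none))
    by-choice valid (just (b , a)) chosen = on-candidate b a (isValid⇒valid valid) c
      (trans (ι-valid valid) (cong (toggleChosen F) chosen))
      (trans (ι-valid (valid⇒isValid (toggleAt-valid (isValid⇒valid valid) c)))
        (trans (cong (toggleChosen (toggleAt F b a)) chosen′) (toggleAt-involutive F b a)))
      where
      c = choice-just (candidates? (mins F)) chosen
      chosen′ : choice (mins (toggleAt F b a)) ≡ just (b , a)
      chosen′ = trans (cong choice (mins-toggleAt F b a (Candidate.least< c))) chosen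
    by-validity : ∀ v → isValid kind F ≡ v → ιCase F
    by-validity false F-invalid = on-invalid F-invalid
    by-validity true  F-valid   = by-choice F-valid _ refl

  ι-involutive : ∀ F → ι (ι F) ≡ F
  ι-involutive F = by-cases (ι-case F)
    where
    by-cases : ιCase F → ι (ι F) ≡ F
    by-cases (on-invalid F-invalid)            = trans (cong ι (ι-invalid F-invalid)) (ι-invalid F-invalid)
    by-cases (on-fixed _ ιF≡F)                 = trans (cong ι ιF≡F) ιF≡F
    by-cases (on-candidate b a _ _ ιF≡ ι-back) = trans (cong ι ιF≡) ι-back

  ι-fixed : ∀ {f} → Fixed f → ι f ≡ f
  ι-fixed {f} fixed-f = by-cases (ι-case f)
    where
    by-cases : ιCase f → ι f ≡ f
    by-cases (on-invalid f-invalid)     = ι-invalid f-invalid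
    by-cases (on-fixed _ ιf≡f)          = ιf≡f
    by-cases (on-candidate b a _ c _ _) = ⊥-elim (Fixed.no-candidate fixed-f b a c)

module SpecialisedWeights (n : ℕ) {la mu : List ℕ} (sp-la : IsStrictPartition la) (sp-mu : IsStrictPartition mu)
                          (la⊇mu : la ⊇ mu) (kind : Kind) where
  open Fillings n sp-la sp-mu la⊇mu
  open Candidates n sp-la sp-mu la⊇mu kind
  open FixedPoints n sp-la sp-mu la⊇mu kind
  open Involution n sp-la sp-mu la⊇mu kind
  open SubsetVectors
  open Coefficients
  open Tab n la mu using (count; totalSize; omega; specTerm; allFillings)
  open import Data.Integer using (_+_; _*_; _-_; _⊖_)
  open FiniteSums
  open Enumerations
  open SignReversingInvolutions

  s : ℕ
  s = skewSize la mu

  totalSize≡∥∥ : ∀ F → totalSize F ≡ ∥ F ∥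
  totalSize≡∥∥ F = begin
    sum (map (count ∘ lookup ∘ lookup F) (allFin _))
      ≡⟨ cong sum (Listₚ.map-tabulate id (count ∘ lookup ∘ lookup F)) ⟩
    sum (tabulate (count ∘ lookup ∘ lookup F))
      ≡⟨ cong sum (Listₚ.tabulate-cong (count-lookup ∘ lookup F)) ⟩
    sum (tabulate (∣_∣ ∘ lookup F))
      ≡⟨ sum-tabulate-∣∣ F ⟩
    ∥ F ∥
      ∎
    where open ≡-Reasoning

  ∥toggleAt∥ : ∀ F b a → ∥ toggleAt F b a ∥ ≡ suc ∥ F ∥ ⊎ ∥ F ∥ ≡ suc ∥ toggleAt F b a ∥
  ∥toggleAt∥ F b a with T? (lookup (lookup F b) a)
  ... | no  a∉ = inj₁ (∥updateAt∥ F b (∣toggle∣ (lookup F b) a a∉))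
  ... | yes a∈ = inj₂ (trans (cong ∥_∥ (sym (toggleAt-involutive F b a)))
                             (∥updateAt∥ (toggleAt F b a) b (∣toggle∣ (lookup (toggleAt F b a) b) a a∉′)))
    where
    a∉′ : ¬ T (lookup (lookup (toggleAt F b a) b) a)
    a∉′ a∈′ = to BooleanReflection.T-not (subst T (toggleAt-self F b a) a∈′) a∈

  s≤∥∥ : ∀ F → Valid kind F → s ≤ ∥ F ∥
  s≤∥∥ F valid =
    subst (_≤ ∥ F ∥) length-boxes (∥∥-≥ F (λ p → ∣∣-pos (lookup F p) _ (proj₂ (Valid.nonempty valid p))))

  fixed-size : ∀ {f} → Fixed f → ∥ f ∥ ≡ s
  fixed-size {f} fixed = trans (∥∥-≡ f one) length-boxes
    where
    one : ∀ p → ∣ lookup f p ∣ ≡ 1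
    one p = trans (cong ∣_∣ (sym (fixed-keepLeast fixed p)))
                  (∣keepLeast∣ (lookup f p) _ (proj₂ (Valid.nonempty (Fixed.valid fixed) p)))

  signPow-suc : ∀ {t} → s ≤ t → signPow (suc t ∸ s) ≡ - signPow (t ∸ s)
  signPow-suc s≤t = cong signPow (ℕ.+-∸-assoc 1 s≤t)

  signPow-toggleAt : ∀ {F b a} → Valid kind F → Valid kind (toggleAt F b a) →
                     signPow (totalSize (toggleAt F b a) ∸ s) ≡ - signPow (totalSize F ∸ s)
  signPow-toggleAt {F} {b} {a} valid valid′
    rewrite totalSize≡∥∥ F | totalSize≡∥∥ (toggleAt F b a) with ∥toggleAt∥ F b a
  ... | inj₁ grows  rewrite grows  = signPow-suc (s≤∥∥ F valid)
  ... | inj₂ shrinks rewrite shrinks =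
    trans (sym (ℤ.neg-involutive _)) (cong -_ (sym (signPow-suc (s≤∥∥ (toggleAt F b a) valid′))))

  weight : Filling n la mu → ℤ
  weight F = if isValid kind F then signPow (totalSize F ∸ s) else + 0

  weight-valid : ∀ {F} → isValid kind F ≡ true → weight F ≡ signPow (totalSize F ∸ s)
  weight-valid {F} valid = cong (λ v → if v then signPow (totalSize F ∸ s) else + 0) valid

  weight-invalid : ∀ {F} → isValid kind F ≡ false → weight F ≡ + 0
  weight-invalid {F} invalid = cong (λ v → if v then signPow (totalSize F ∸ s) else + 0) invalid

  weight-flips : ∀ {f} → Fixed f → ∀ F → F ≢ f → weight (ι F) ≡ - weight F
  weight-flips {f} fixed-f F F≢f = by-cases (ι-case F)
    where
    open ≡-Reasoning
    by-cases : ιCase F → weight (ι F) ≡ - weight F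
    by-cases (on-invalid F-invalid) = trans (cong weight (ι-invalid F-invalid))
                                     (trans (weight-invalid F-invalid) (cong -_ (sym (weight-invalid F-invalid))))
    by-cases (on-fixed fixed-F _)   = ⊥-elim (F≢f (fixed-unique fixed-F fixed-f))
    by-cases (on-candidate b a valid c ιF≡ _) = begin
      weight (ι F)                               ≡⟨ cong weight ιF≡ ⟩
      weight (toggleAt F b a)                    ≡⟨ weight-valid (valid⇒isValid valid′) ⟩
      signPow (totalSize (toggleAt F b a) ∸ s)   ≡⟨ signPow-toggleAt {F} {b} {a} valid valid′ ⟩
      - signPow (totalSize F ∸ s)                ≡⟨ cong -_ (weight-valid (valid⇒isValid valid)) ⟨
      - weight F                                 ∎
      where
      valid′ : Valid kind (toggleAt F b a)
      valid′ = toggleAt-valid valid c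

  weight-fixed : ∀ {f} → Fixed f → weight f ≡ + 1
  weight-fixed {f} fixed = begin
    weight f                    ≡⟨ weight-valid (valid⇒isValid (Fixed.valid fixed)) ⟩
    signPow (totalSize f ∸ s)   ≡⟨ cong (λ t → signPow (t ∸ s)) (trans (totalSize≡∥∥ f) (fixed-size fixed)) ⟩
    signPow (s ∸ s)             ≡⟨ cong signPow (ℕ.n∸n≡0 s) ⟩
    + 1                         ∎
    where open ≡-Reasoning

  ∑-weight : ∀ F₀ → Valid kind F₀ → ∑ allFillings weight ≡ + 1
  ∑-weight F₀ valid₀ =
    let f , fixed = fixed-exists F₀ valid₀ in
    trans (∑-signReversing _≟ᶠ_ allFillings allFillings-isEnumeration ι ι-involutive
                           weight f (ι-fixed fixed) (weight-flips fixed))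
          (weight-fixed fixed)

  letterIndex-once : ∀ (a : Letter n) → ∑[ k ∈ map suc (upTo n) ] 𝟙 (letterIndex n a ≡ᵇ k) ≡ + 1
  letterIndex-once a = trans (∑-map suc (upTo n) _)
    (∑-upTo-𝟙 {n} {toℕ a / 2} (m<n*o⇒m/o<n (subst (toℕ a <_) (ℕ.*-comm 2 n) (Fin.toℕ<n a))))

  count-by-index : ∀ (f : Letter n → Bool) →
                   ∑[ k ∈ map suc (upTo n) ] + count (λ a → f a ∧ (letterIndex n a ≡ᵇ k)) ≡ + count f
  count-by-index f = begin
    ∑[ k ∈ ks ] + count (λ a → f a ∧ (letterIndex n a ≡ᵇ k))
      ≡⟨ ∑-cong ks (λ k → pos-length-filter as _) ⟩
    ∑[ k ∈ ks ] ∑[ a ∈ as ] 𝟙 (f a ∧ (letterIndex n a ≡ᵇ k))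
      ≡⟨ ∑-comm ks as (λ k a → 𝟙 (f a ∧ (letterIndex n a ≡ᵇ k))) ⟩
    ∑[ a ∈ as ] ∑[ k ∈ ks ] 𝟙 (f a ∧ (letterIndex n a ≡ᵇ k))
      ≡⟨ ∑-cong as (λ a → ∑-cong ks (λ k → 𝟙-∧ (f a) _)) ⟩
    ∑[ a ∈ as ] ∑[ k ∈ ks ] 𝟙 (f a) * 𝟙 (letterIndex n a ≡ᵇ k)
      ≡⟨ ∑-cong as (λ a → ∑-*ˡ ks (𝟙 (f a)) (λ k → 𝟙 (letterIndex n a ≡ᵇ k))) ⟩
    ∑[ a ∈ as ] 𝟙 (f a) * (∑[ k ∈ ks ] 𝟙 (letterIndex n a ≡ᵇ k))
      ≡⟨ ∑-cong as (λ a → trans (cong (𝟙 (f a) *_) (letterIndex-once a)) (ℤ.*-identityʳ _)) ⟩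
    ∑[ a ∈ as ] 𝟙 (f a)
      ≡⟨ pos-length-filter as f ⟨
    + count f
      ∎
    where
    open ≡-Reasoning
    ks = map suc (upTo n)
    as = allFin _

  omega-total : ∀ F → sum (map (omega F) (map suc (upTo n))) ≡ totalSize F
  omega-total F = ℤ.+-injective (begin
    + sum (map (omega F) ks)                                         ≡⟨ pos-sum ks (omega F) ⟩
    ∑[ k ∈ ks ] + omega F k                                          ≡⟨ ∑-cong ks (λ k → pos-sum ps _) ⟩
    ∑[ k ∈ ks ] ∑[ p ∈ ps ] + count (λ a → entry p a ∧ (letterIndex n a ≡ᵇ k))
      ≡⟨ ∑-comm ks ps (λ k p → + count (λ a → entry p a ∧ (letterIndex n a ≡ᵇ k))) ⟩
    ∑[ p ∈ ps ] ∑[ k ∈ ks ] + count (λ a → entry p a ∧ (letterIndex n a ≡ᵇ k))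
      ≡⟨ ∑-cong ps (λ p → count-by-index (entry p)) ⟩
    ∑[ p ∈ ps ] + count (entry p)                                     ≡⟨ pos-sum ps (count ∘ entry) ⟨
    + totalSize F                                                     ∎)
    where
    open ≡-Reasoning
    ks = map suc (upTo n)
    ps = allFin (length (boxes la mu))
    entry : Pos → Letter n → Bool
    entry p = lookup (lookup F p)

  specTerm-exponent : ∀ F → s ≤ totalSize F → proj₂ (specTerm F) ≡ + s
  specTerm-exponent F s≤t = begin
    + sum (map (omega F) (map suc (upTo n))) - + (t ∸ s)  ≡⟨ cong (λ x → + x - + (t ∸ s)) (omega-total F) ⟩
    + t - + (t ∸ s)                                       ≡⟨ ℤ.m-n≡m⊖n t (t ∸ s) ⟩
    t ⊖ (t ∸ s)                                           ≡⟨ ℤ.⊖-≥ (ℕ.m∸n≤m t s) ⟩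
    + (t ∸ (t ∸ s))                                       ≡⟨ cong +_ (ℕ.m∸[m∸n]≡n s≤t) ⟩
    + s                                                   ∎
    where
    open ≡-Reasoning
    t = totalSize F

  summand-coeff : ∀ F e → (if isValid kind F then monomialCoeff (specTerm F) e else + 0)
                        ≡ 𝟙 (does (+ s ℤ.≟ e)) * weight F
  summand-coeff F e = by-validity (isValid kind F) refl
    where
    open ≡-Reasoning
    if-then-0 : ∀ b c → (if b then c else + 0) ≡ 𝟙 b * c
    if-then-0 true  c = sym (ℤ.*-identityˡ c)
    if-then-0 false c = sym (ℤ.*-zeroˡ c)
    by-validity : ∀ v → isValid kind F ≡ v →
                  (if isValid kind F then monomialCoeff (specTerm F) e else + 0) ≡ 𝟙 (does (+ s ℤ.≟ e)) * weight F
    by-validity false invalid = trans (cong (λ v → if v then monomialCoeff (specTerm F) e else + 0) invalid)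
      (sym (trans (cong (𝟙 (does (+ s ℤ.≟ e)) *_) (weight-invalid invalid)) (ℤ.*-zeroʳ (𝟙 (does (+ s ℤ.≟ e))))))
    by-validity true valid = begin
      (if isValid kind F then monomialCoeff (specTerm F) e else + 0)
        ≡⟨ cong (λ v → if v then monomialCoeff (specTerm F) e else + 0) valid ⟩
      (if does (proj₂ (specTerm F) ℤ.≟ e) then signPow (totalSize F ∸ s) else + 0)
        ≡⟨ cong (λ d → if does (d ℤ.≟ e) then signPow (totalSize F ∸ s) else + 0) (specTerm-exponent F s≤t) ⟩
      (if does (+ s ℤ.≟ e) then signPow (totalSize F ∸ s) else + 0)
        ≡⟨ if-then-0 (does (+ s ℤ.≟ e)) (signPow (totalSize F ∸ s)) ⟩
      𝟙 (does (+ s ℤ.≟ e)) * signPow (totalSize F ∸ s)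
        ≡⟨ cong (𝟙 (does (+ s ℤ.≟ e)) *_) (weight-valid valid) ⟨
      𝟙 (does (+ s ℤ.≟ e)) * weight F
        ∎
      where
      s≤t : s ≤ totalSize F
      s≤t = subst (s ≤_) (sym (totalSize≡∥∥ F)) (s≤∥∥ F (isValid⇒valid valid))

  specialisation : ∀ F₀ → isValid kind F₀ ≡ true →
                   map specTerm (filter (T? ∘ isValid kind) allFillings) ≈L βpow (+ s)
  specialisation F₀ valid₀ e = begin
    coeff (map specTerm (filter (T? ∘ isValid kind) allFillings)) e
      ≡⟨ coeff-map-filter allFillings (isValid kind) specTerm e ⟩
    ∑[ F ∈ allFillings ] (if isValid kind F then monomialCoeff (specTerm F) e else + 0)
      ≡⟨ ∑-cong allFillings (λ F → summand-coeff F e) ⟩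
    ∑[ F ∈ allFillings ] 𝟙 (does (+ s ℤ.≟ e)) * weight F
      ≡⟨ ∑-*ˡ allFillings (𝟙 (does (+ s ℤ.≟ e))) weight ⟩
    𝟙 (does (+ s ℤ.≟ e)) * ∑ allFillings weight
      ≡⟨ cong (𝟙 (does (+ s ℤ.≟ e)) *_) (∑-weight F₀ (isValid⇒valid valid₀)) ⟩
    𝟙 (does (+ s ℤ.≟ e)) * + 1
      ≡⟨ trans (ℤ.*-identityʳ (𝟙 (does (+ s ℤ.≟ e)))) (sym (ℤ.+-identityʳ (𝟙 (does (+ s ℤ.≟ e))))) ⟩
    coeff (βpow (+ s)) e
      ∎
    where open ≡-Reasoning

theorem4p1 : (n : ℕ) → 1 ≤ n → (la mu : List ℕ)
    → IsStrictPartition la → IsStrictPartition mu → la ⊇ mu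
    → ∃ (λ (T : Filling n la mu) → isSSVT-P n la mu T ≡ true)
    → ∃ (λ (T : Filling n la mu) → isSSVT-Q n la mu T ≡ true)
    → (GPspec n la mu ≈L βpow (+ skewSize la mu))
    × (GQspec n la mu ≈L βpow (+ skewSize la mu))
theorem4p1 n _ la mu sp-la sp-mu la⊇mu (F₁ , valid₁) (F₂ , valid₂) =
  GP.specialisation F₁ valid₁ , GQ.specialisation F₂ valid₂
  where
  module GP = SpecialisedWeights n sp-la sp-mu la⊇mu P
  module GQ = SpecialisedWeights n sp-la sp-mu la⊇mu Q
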